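{- Let $\ell \geq 2$ and $k \geq 1$ be integers and let $G$ be a graph no connected component of which is a clique or an $\ell$-clique. If there exists an edition set $F$ for $G$ with $|F| = k$ such that $G+F$ is an $\mathcal{L}_\ell$-cluster graph, then $|V(G_{\mathrm{Q}})| \leq (2\ell+2)k$, $|\mathcal{P}(G_{\mathrm{Q}})| \leq 2\ell k$ and $|\mathcal{S}(G_{\mathrm{Q}})| \leq 2k$.
   Context: All graphs are finite, simple and undirected. A clique is a complete graph; an $\ell$-clique is a connected complete $\ell$-partite graph. An $\mathcal{L}_\ell$-cluster graph is a graph each of whose connected components is a clique or an $\ell$-clique. An edition set $F$ for $G$ is a set of unordered pairs of distinct vertices of $G$, no pair occurring twice, each marked $-$ (an edge of $G$ to be deleted) or $+$ (a non-edge of $G$ to be added); $G+F$ is the resulting graph. Modular decomposition: a module of $G$ is a set $M \subseteq V(G)$ such that every vertex outside $M$ is adjacent to all or to none of the vertices of $M$. A module is strong if for every module $M'$ either $M \cap M' = \emptyset$ or one of $M, M'$ contains the other. The modular decomposition tree $T_G$ has the strong modules of $G$ as nodes, $V(G)$ as root and the singletons $\{v\}$ as leaves; the children of an internal node $M$ are the maximal strong modules properly contained in $M$. An internal node $M$ is labelled P if $G[M]$ is disconnected, S if the complement of $G[M]$ is disconnected, and N otherwise. Q-partition and Q-quotient graph: the Q-partition $\Pi$ of $V(G)$ is defined by: if $\{x\}$ is a leaf child of a node labelled N, then $\{x\}$ is a part of $\Pi$; if $\{x_1\},\dots,\{x_j\}$ are all the leaf children of a node labelled P or S, then $\{x_1,\dots,x_j\}$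 is a part of $\Pi$. Each part is a module, so between two distinct parts either all or no edges are present. The Q-quotient graph $G_{\mathrm{Q}}$ has the parts of $\Pi$ as vertices, two parts being adjacent iff there are edges of $G$ between them. A vertex of $G_{\mathrm{Q}}$ is a U-vertex if its part is a singleton, a P-vertex if its part (of size at least two) consists of the leaf children of a node labelled P, and an S-vertex if its part (of size at least two) consists of the leaf children of a node labelled S. $\mathcal{P}(G_{\mathrm{Q}})$ and $\mathcal{S}(G_{\mathrm{Q}})$ denote the sets of P-vertices and S-vertices of $G_{\mathrm{Q}}$. -}

module Defs where

open import Data.Nat using (ℕ; _≤_)
open import Data.Bool using (Bool; true; false; not; _xor_; _∧_; _∨_; if_then_else_)
open import Data.Fin using (Fin; _≟_) renaming (_<_ to _<ᶠ_)
open import Data.Fin.Subset using (Subset; _∈_; _∉_; _⊆_; ⁅_⁆; ∣_∣; Nonempty)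
open import Data.List using (List; length)
open import Data.Bool.ListAction using (any)
open import Data.List.Relation.Unary.All using (All)
open import Data.List.Relation.Unary.Unique.Propositional using (Unique)
open import Data.Product using (Σ; ∃; _×_; _,_; proj₁; proj₂)
open import Data.Sum using (_⊎_)
open import Relation.Nullary using (¬_)
open import Relation.Nullary.Decidable using (⌊_⌋)
open import Relation.Binary.PropositionalEquality using (_≡_; _≢_)

Adj : ℕ → Set
Adj n = Fin n → Fin n → Bool

record Graph (n : ℕ) : Set where
  field
    adj    : Adj n
    sym    : ∀ x y → adj x y ≡ adj y x
    irrefl : ∀ x → adj x x ≡ false
open Graph public

module _ {n : ℕ} where

  co : Adj n → Adj n
  co A x y = if ⌊ x ≟ y ⌋ then false else not (A x y)

  data Reach (A : Adj n) (M : Subset n) : Fin n → Fin n → Set where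
    here : ∀ {x} → Reach A M x x
    step : ∀ {x y z} → x ∈ M → y ∈ M → A x y ≡ true → Reach A M y z → Reach A M x z

  Connected : Adj n → Subset n → Set
  Connected A M = ∀ x y → x ∈ M → y ∈ M → Reach A M x y

  IsComponent : Adj n → Subset n → Set
  IsComponent A C = Nonempty C × Connected A C × (∀ x y → x ∈ C → A x y ≡ true → y ∈ C)

  IsCliqueOn : Adj n → Subset n → Set
  IsCliqueOn A C = ∀ x y → x ∈ C → y ∈ C → x ≢ y → A x y ≡ true

  -- A[C] is an ℓ-clique: a connected complete ℓ-partite graph (ℓ nonempty parts)
  IsLCliqueOn : ℕ → Adj n → Subset n → Set
  IsLCliqueOn ℓ A C =
    Connected A C ×
    Σ (Fin n → Fin ℓ) λ c →
      (∀ i → ∃ λ x → x ∈ C × c x ≡ i) ×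
      (∀ x y → x ∈ C → y ∈ C → (A x y ≡ true → c x ≢ c y) × (c x ≢ c y → A x y ≡ true))

  IsLCluster : ℕ → Adj n → Set
  IsLCluster ℓ A = ∀ C → IsComponent A C → IsCliqueOn A C ⊎ IsLCliqueOn ℓ A C

  -- Edition sets: a list of unordered pairs {x,y}, each stored canonically as (x , y) with x < y,
  -- without repetition. The mark (−/+) of a pair is determined by whether it is an edge of G.
  IsEditionSet : List (Fin n × Fin n) → Set
  IsEditionSet F = All (λ p → proj₁ p <ᶠ proj₂ p) F × Unique F

  inF : List (Fin n × Fin n) → Fin n → Fin n → Bool
  inF F x y = any (λ p → (⌊ proj₁ p ≟ x ⌋ ∧ ⌊ proj₂ p ≟ y ⌋) ∨ (⌊ proj₁ p ≟ y ⌋ ∧ ⌊ proj₂ p ≟ x ⌋)) F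

  edit : Adj n → List (Fin n × Fin n) → Adj n
  edit A F x y = A x y xor inF F x y

  IsModule : Adj n → Subset n → Set
  IsModule A M = ∀ v → v ∉ M → ∀ x y → x ∈ M → y ∈ M → A v x ≡ A v y

  Disjoint : Subset n → Subset n → Set
  Disjoint M M' = ∀ x → x ∈ M → x ∉ M'

  IsStrongModule : Adj n → Subset n → Set
  IsStrongModule A M =
    IsModule A M × (∀ M' → IsModule A M' → Disjoint M M' ⊎ (M ⊆ M' ⊎ M' ⊆ M))

  -- nodes of the modular decomposition tree T_G: the (nonempty) strong modules
  IsNode : Adj n → Subset n → Set
  IsNode A M = Nonempty M × IsStrongModule A M

  _⊊_ : Subset n → Subset n → Set
  M ⊊ M' = M ⊆ M' × ∃ λ x → x ∈ M' × x ∉ M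

  IsChild : Adj n → Subset n → Subset n → Set
  IsChild A C M =
    IsNode A M × IsNode A C × C ⊊ M × (∀ S → IsNode A S → C ⊊ S → ¬ (S ⊊ M))

  LeafChildOf : Adj n → Fin n → Subset n → Set
  LeafChildOf A x M = IsChild A ⁅ x ⁆ M

  LabelP : Adj n → Subset n → Set
  LabelP A M = ¬ Connected A M

  LabelS : Adj n → Subset n → Set
  LabelS A M = ¬ Connected (co A) M

  LabelN : Adj n → Subset n → Set
  LabelN A M = ¬ LabelP A M × ¬ LabelS A M

  LeafChildrenOf : Adj n → Subset n → Subset n → Set
  LeafChildrenOf A M P =
    (∃ λ x → LeafChildOf A x M) ×
    (∀ y → y ∈ P → LeafChildOf A y M) × (∀ y → LeafChildOf A y M → y ∈ P)

  -- parts of the Q-partition Π (= vertices of G_Q)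
  IsQPart : Adj n → Subset n → Set
  IsQPart A P =
    (Σ (Fin n) λ x → Σ (Subset n) λ M → LeafChildOf A x M × LabelN A M × P ≡ ⁅ x ⁆) ⊎
    (Σ (Subset n) λ M → (LabelP A M ⊎ LabelS A M) × LeafChildrenOf A M P)

  IsPVertex : Adj n → Subset n → Set
  IsPVertex A P =
    IsQPart A P × 2 ≤ ∣ P ∣ × (Σ (Subset n) λ M → LabelP A M × LeafChildrenOf A M P)

  IsSVertex : Adj n → Subset n → Set
  IsSVertex A P =
    IsQPart A P × 2 ≤ ∣ P ∣ × (Σ (Subset n) λ M → LabelS A M × LeafChildrenOf A M P)

  -- "the set of parts satisfying Q has at most B elements":
  -- every duplicate-free list of such parts has length ≤ B
  AtMost : ℕ → (Subset n → Set) → Set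
  AtMost B Q = ∀ (L : List (Subset n)) → Unique L → All Q L → length L ≤ B

-- Let H = G + F and call the at most 2k endpoints of the pairs of F touched.  Untouched vertices have
-- the same neighbourhood in G and in H; every component of the L_ℓ-cluster graph H contains a touched
-- vertex, as otherwise it would be a clique or ℓ-clique component of G; and in a component of H two
-- vertices of the same colour class (any two vertices, in a clique) are twins.  Untouched H-twins are
-- G-twins, and G-twins lie in the same part of the Q-partition: a twin pair has a single parent in the
-- modular decomposition tree, and two leaf children of an N-node are never twins.  So charging a part
-- to a touched vertex it contains, or else to a touched vertex x of its H-component together with the
-- colour of the part there, is injective, whence |V(G_Q)| ≤ 2k + 2kℓ.  For P- and S-vertices a part
-- containing touched vertices is charged to a designated one (with its own colour, for P), and an
-- untouched part to a touched vertex of its component designated by no part: for S-vertices no colour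
-- is needed, since untouched S-vertices are universal in their component.

module Submission where

open import Defs hiding (sym)
open import Data.Nat using (ℕ; suc; _≤_; _+_; _*_; z≤n; s≤s)
open import Data.Nat.Properties using (≤-reflexive; ≤-trans)
open import Data.Nat.Tactic.RingSolver using (solve-∀)
open import Data.Bool using (true; false; not; T; _∧_; _∨_; _xor_) renaming (_≟_ to _≟ᵇ_)
open import Data.Bool.Properties
  using (not-injective; ¬-not; not-¬; ∨-comm; xor-identityʳ; xor-comm; T-≡; T-∨; T-∧)
open import Data.Fin using (Fin; _≟_; fromℕ<)
open import Data.Fin.Properties using (any?; all?; <-irrefl)
open import Data.Fin.Subset using (Subset; _∈_; _∉_; _⊆_; _⊂_; _⊃_; _∪_; ⁅_⁆; ∣_∣; Nonempty)
open import Data.Fin.Subset.Properties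
  using (_∈?_; _⊂?_; anySubset?; x∈⁅x⁆; x∈⁅y⁆⇒x≡y; x∉⁅y⁆⇒x≢y; x≢y⇒x∉⁅y⁆; ∣⁅x⁆∣≡1; p⊆q⇒∣p∣≤∣q∣;
         p⊆p∪q; q⊆p∪q; x∈p∪q⁻; ⊆-antisym; ∪-comm)
open import Data.Fin.Subset.Induction using (⊃-wellFounded; Acc; acc)
open import Data.List using (List; []; _∷_; length; map; _++_; cartesianProduct; allFin)
open import Data.List.Properties using (length-++; length-map; length-tabulate)
open import Data.List.Membership.Propositional using (find; lose) renaming (_∈_ to _∈ₗ_)
open import Data.List.Membership.Propositional.Properties
  using (∈-∃++; ∈-++⁻; ∈-++⁺ˡ; ∈-++⁺ʳ; ∈-map⁺; ∈-cartesianProduct⁺; ∈-allFin)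
open import Data.List.Relation.Unary.Any as Any using (Any; here; there)
open import Data.List.Relation.Unary.Any.Properties using (any⁻)
open import Data.List.Relation.Unary.All as All using (All)
open import Data.List.Relation.Unary.All.Properties using (All¬⇒¬Any)
open import Data.List.Relation.Unary.AllPairs using (_∷_)
open import Data.List.Relation.Unary.Unique.Propositional using (Unique)
open import Data.Maybe using (Maybe; just; nothing)
open import Data.Maybe.Properties using (just-injective) renaming (≡-dec to ≡-dec-Maybe)
open import Data.Product using (Σ; ∃; ∃₂; _×_; _,_; proj₁; proj₂)
open import Data.Sum using (_⊎_; inj₁; inj₂; [_,_])
open import Data.Empty using (⊥; ⊥-elim)
open import Function using (_∘_)
open import Function.Bundles using (Equivalence)
open import Relation.Nullary using (¬_; yes; no; contradiction)
open import Relation.Nullary.Decidable using (_×-dec_; _→-dec_; ¬?; ⌊_⌋; toWitness; decidable-stable)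
open import Relation.Unary using (Pred) renaming (Decidable to Decidable₁)
open import Relation.Binary using (Rel) renaming (Decidable to Decidable₂)
open import Relation.Binary.Construct.Closure.ReflexiveTransitive using (Star; ε; _◅_; _◅◅_; reverse)
open import Relation.Binary.PropositionalEquality
  using (_≡_; _≢_; refl; sym; trans; cong; cong₂; subst; module ≡-Reasoning)

-- Counting by an injective charging

module _ {a} {A : Set a} where

  ∈-++-∷⁻ : ∀ (ys₁ : List A) {ys₂ y z} → z ∈ₗ ys₁ ++ y ∷ ys₂ → z ≢ y → z ∈ₗ ys₁ ++ ys₂
  ∈-++-∷⁻ ys₁ z∈ z≢y with ∈-++⁻ ys₁ z∈
  ... | inj₁ z∈ys₁       = ∈-++⁺ˡ z∈ys₁
  ... | inj₂ (here z≡y)  = ⊥-elim (z≢y z≡y)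
  ... | inj₂ (there z∈ys₂) = ∈-++⁺ʳ ys₁ z∈ys₂

  length-++-∷ : ∀ (ys₁ : List A) {ys₂ y} → length (ys₁ ++ y ∷ ys₂) ≡ suc (length (ys₁ ++ ys₂))
  length-++-∷ []       = refl
  length-++-∷ (_ ∷ ys₁) = cong suc (length-++-∷ ys₁)

module _ {a b r} {A : Set a} {B : Set b} (R : A → B → Set r) where

  length-≤-of-injective-charge : ∀ {xs : List A} {ys : List B} → Unique xs →
    (∀ {x} → x ∈ₗ xs → ∃ λ y → y ∈ₗ ys × R x y) →
    (∀ {x x′ y} → x ∈ₗ xs → x′ ∈ₗ xs → R x y → R x′ y → x ≡ x′) →
    length xs ≤ length ys
  length-≤-of-injective-charge {[]}     _              _      _   = z≤n
  length-≤-of-injective-charge {x ∷ xs} (x∉xs ∷ uniq) charge inj with charge (here refl)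
  ... | y , y∈ys , Rxy with ∈-∃++ y∈ys
  ... | ys₁ , ys₂ , refl =
    ≤-trans (s≤s (length-≤-of-injective-charge uniq charge′ (λ p q → inj (there p) (there q))))
            (≤-reflexive (sym (length-++-∷ ys₁)))
    where
    charge′ : ∀ {x′} → x′ ∈ₗ xs → ∃ λ y′ → y′ ∈ₗ ys₁ ++ ys₂ × R x′ y′
    charge′ x′∈xs with charge (there x′∈xs)
    ... | y′ , y′∈ys , Rx′y′ = y′ , ∈-++-∷⁻ ys₁ y′∈ys y′≢y , Rx′y′
      where
      y′≢y : y′ ≢ y
      y′≢y refl = All¬⇒¬Any x∉xs (subst (_∈ₗ xs) (inj (there x′∈xs) (here refl) Rx′y′ Rxy) x′∈xs)

module _ {a b} {A : Set a} {B : Set b} where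

  length-cartesianProduct : ∀ (xs : List A) (ys : List B) →
    length (cartesianProduct xs ys) ≡ length xs * length ys
  length-cartesianProduct []       ys = refl
  length-cartesianProduct (x ∷ xs) ys = begin
    length (map (x ,_) ys ++ cartesianProduct xs ys)
      ≡⟨ length-++ (map (x ,_) ys) ⟩
    length (map (x ,_) ys) + length (cartesianProduct xs ys)
      ≡⟨ cong₂ _+_ (length-map (x ,_) ys) (length-cartesianProduct xs ys) ⟩
    length ys + length xs * length ys
      ∎
    where open ≡-Reasoning

length-allFin : ∀ k → length (allFin k) ≡ k
length-allFin k = length-tabulate (λ i → i)

-- Subsets, reachability and connected components

module _ {n : ℕ} where

  ⊆-or-∉ : ∀ (p q : Subset n) → p ⊆ q ⊎ ∃ λ x → x ∈ p × x ∉ q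
  ⊆-or-∉ p q with any? (λ x → x ∈? p ×-dec ¬? (x ∈? q))
  ... | yes (x , x∈p , x∉q) = inj₂ (x , x∈p , x∉q)
  ... | no  ∄x = inj₁ λ {x} x∈p → decidable-stable (x ∈? q) λ x∉q → ∄x (x , x∈p , x∉q)

  disjoint-or-meet : ∀ (p q : Subset n) → Disjoint p q ⊎ ∃ λ x → x ∈ p × x ∈ q
  disjoint-or-meet p q with any? (λ x → x ∈? p ×-dec x ∈? q)
  ... | yes (x , x∈p , x∈q) = inj₂ (x , x∈p , x∈q)
  ... | no  ∄x = inj₁ λ x x∈p x∈q → ∄x (x , x∈p , x∈q)

  ∃-other : ∀ {p : Subset n} {x} → 2 ≤ ∣ p ∣ → x ∈ p → ∃ λ y → y ∈ p × y ≢ x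
  ∃-other {p} {x} 2≤∣p∣ x∈p with ⊆-or-∉ p ⁅ x ⁆
  ... | inj₂ (y , y∈p , y∉⁅x⁆) = y , y∈p , x∉⁅y⁆⇒x≢y y∉⁅x⁆
  ... | inj₁ p⊆⁅x⁆ with ≤-trans 2≤∣p∣ (≤-trans (p⊆q⇒∣p∣≤∣q∣ p⊆⁅x⁆) (≤-reflexive (∣⁅x⁆∣≡1 x)))
  ... | s≤s ()

  ⁅⁆⊆ : ∀ {x} {p : Subset n} → x ∈ p → ⁅ x ⁆ ⊆ p
  ⁅⁆⊆ {x} {p} x∈p y∈⁅x⁆ = subst (_∈ p) (sym (x∈⁅y⁆⇒x≡y x y∈⁅x⁆)) x∈p

  pair : Fin n → Fin n → Subset n
  pair x y = ⁅ x ⁆ ∪ ⁅ y ⁆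

  ∈-pairˡ : ∀ x y → x ∈ pair x y
  ∈-pairˡ x y = p⊆p∪q ⁅ y ⁆ (x∈⁅x⁆ x)

  ∈-pairʳ : ∀ x y → y ∈ pair x y
  ∈-pairʳ x y = q⊆p∪q ⁅ x ⁆ ⁅ y ⁆ (x∈⁅x⁆ y)

  ∈-pair⁻ : ∀ {x y z} → z ∈ pair x y → z ≡ x ⊎ z ≡ y
  ∈-pair⁻ {x} {y} z∈ with x∈p∪q⁻ ⁅ x ⁆ ⁅ y ⁆ z∈
  ... | inj₁ z∈⁅x⁆ = inj₁ (x∈⁅y⁆⇒x≡y x z∈⁅x⁆)
  ... | inj₂ z∈⁅y⁆ = inj₂ (x∈⁅y⁆⇒x≡y y z∈⁅y⁆)

  grow : ∀ {p q} (P : Pred (Subset n) p) (Done : Pred (Subset n) q) →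
    (∀ {S} → P S → Done S ⊎ ∃ λ S′ → P S′ × S ⊂ S′) →
    ∀ {S} → P S → ∃ λ S′ → P S′ × Done S′
  grow P Done enlarge {S} = go (⊃-wellFounded S)
    where
    go : ∀ {S} → Acc _⊃_ S → P S → ∃ λ S′ → P S′ × Done S′
    go (acc larger) pS with enlarge pS
    ... | inj₁ done               = _ , pS , done
    ... | inj₂ (S′ , pS′ , S⊂S′) = go (larger S⊂S′) pS′

  module Reachable {r} (E : Rel (Fin n) r) (E? : Decidable₂ E) (v : Fin n) where

    ReachedFrom : Subset n → Set r
    ReachedFrom S = v ∈ S × (∀ {x} → x ∈ S → Star E v x)

    ClosedUnder : Subset n → Set r
    ClosedUnder S = ∀ {x y} → x ∈ S → E x y → y ∈ S

    private
      extend : ∀ {S} → ReachedFrom S → ClosedUnder S ⊎ ∃ λ S′ → ReachedFrom S′ × S ⊂ S′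
      extend {S} (v∈S , walk) with any? (λ x → any? λ y → x ∈? S ×-dec E? x y ×-dec ¬? (y ∈? S))
      ... | no ∄edge = inj₁ λ {x} {y} x∈S Exy →
        decidable-stable (y ∈? S) λ y∉S → ∄edge (x , y , x∈S , Exy , y∉S)
      ... | yes (x , y , x∈S , Exy , y∉S) =
        inj₂ (S ∪ ⁅ y ⁆ , (p⊆p∪q ⁅ y ⁆ v∈S , walk′) , p⊆p∪q ⁅ y ⁆ , y , q⊆p∪q S ⁅ y ⁆ (x∈⁅x⁆ y) , y∉S)
        where
        walk′ : ∀ {z} → z ∈ S ∪ ⁅ y ⁆ → Star E v z
        walk′ z∈ with x∈p∪q⁻ S ⁅ y ⁆ z∈
        ... | inj₁ z∈S = walk z∈S
        ... | inj₂ z∈⁅y⁆ rewrite x∈⁅y⁆⇒x≡y y z∈⁅y⁆ = walk x∈S ◅◅ (Exy ◅ ε)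

      start : ReachedFrom ⁅ v ⁆
      start = x∈⁅x⁆ v , λ {x} x∈⁅v⁆ → subst (Star E v) (sym (x∈⁅y⁆⇒x≡y v x∈⁅v⁆)) ε

      closure : Σ (Subset n) λ S → ReachedFrom S × ClosedUnder S
      closure = grow ReachedFrom ClosedUnder extend start

    set : Subset n
    set = proj₁ closure

    v∈set : v ∈ set
    v∈set = proj₁ (proj₁ (proj₂ closure))

    walk : ∀ {x} → x ∈ set → Star E v x
    walk = proj₂ (proj₁ (proj₂ closure))

    closed : ClosedUnder set
    closed = proj₂ (proj₂ closure)

true≢false : ∀ {b} → b ≡ true → b ≡ false → ⊥
true≢false refl ()

module _ {n : ℕ} where

  SymmetricAdj : Adj n → Set
  SymmetricAdj B = ∀ x y → B x y ≡ B y x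

  Edge : Adj n → Rel (Fin n) _
  Edge B x y = B x y ≡ true

  Within : Adj n → Subset n → Rel (Fin n) _
  Within B M x y = x ∈ M × y ∈ M × B x y ≡ true

  edge? : ∀ B → Decidable₂ (Edge B)
  edge? B x y = B x y ≟ᵇ true

  within? : ∀ B M → Decidable₂ (Within B M)
  within? B M x y = x ∈? M ×-dec y ∈? M ×-dec edge? B x y

  edge-sym : ∀ {B} → SymmetricAdj B → ∀ {x y} → Edge B x y → Edge B y x
  edge-sym symB {x} {y} e = trans (symB y x) e

  within-sym : ∀ {B M} → SymmetricAdj B → ∀ {x y} → Within B M x y → Within B M y x
  within-sym symB (x∈M , y∈M , e) = y∈M , x∈M , edge-sym symB e

  star-closed : ∀ {r} {E : Rel (Fin n) r} {S : Subset n} → (∀ {x y} → x ∈ S → E x y → y ∈ S) →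
    ∀ {x y} → x ∈ S → Star E x y → y ∈ S
  star-closed closedS x∈S ε        = x∈S
  star-closed closedS x∈S (e ◅ es) = star-closed closedS (closedS x∈S e) es

  crossing : ∀ {r} {E : Rel (Fin n) r} {S : Subset n} {x y} → Star E x y → x ∈ S → y ∉ S →
    ∃₂ λ u w → Star E x u × E u w × u ∈ S × w ∉ S
  crossing ε x∈S y∉S = contradiction x∈S y∉S
  crossing {S = S} (_◅_ {j = z} e es) x∈S y∉S with z ∈? S
  ... | no  z∉S = _ , z , ε , e , x∈S , z∉S
  ... | yes z∈S with crossing es z∈S y∉S
  ...   | u , w , es′ , e′ , u∈S , w∉S = u , w , e ◅ es′ , e′ , u∈S , w∉S

  within⇒reach : ∀ {B M x y} → Star (Within B M) x y → Reach B M x y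
  within⇒reach ε                        = here
  within⇒reach ((x∈M , y∈M , e) ◅ es) = step x∈M y∈M e (within⇒reach es)

  edges⇒reach : ∀ {B C x y} → (∀ {u w} → u ∈ C → Edge B u w → w ∈ C) → x ∈ C →
    Star (Edge B) x y → Reach B C x y
  edges⇒reach closedC x∈C ε        = here
  edges⇒reach closedC x∈C (e ◅ es) = step x∈C (closedC x∈C e) e (edges⇒reach closedC (closedC x∈C e) es)

  component : Adj n → Fin n → Subset n
  component B = Reachable.set (Edge B) (edge? B)

  componentIn : Adj n → Subset n → Fin n → Subset n
  componentIn B M = Reachable.set (Within B M) (within? B M)

  componentIn-⊆ : ∀ {B M a} → a ∈ M → componentIn B M a ⊆ M
  componentIn-⊆ {B} {M} {a} a∈M x∈ =
    star-closed (λ _ (_ , y∈M , _) → y∈M) a∈M (Reachable.walk (Within B M) (within? B M) a x∈)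

  module _ {B : Adj n} where

    ∈-component : ∀ v → v ∈ component B v
    ∈-component = Reachable.v∈set (Edge B) (edge? B)

    component-walk : ∀ {v x} → x ∈ component B v → Star (Edge B) v x
    component-walk {v} = Reachable.walk (Edge B) (edge? B) v

    component-closed : ∀ {v x y} → x ∈ component B v → Edge B x y → y ∈ component B v
    component-closed {v} = Reachable.closed (Edge B) (edge? B) v

    walk⇒∈component : ∀ {v x} → Star (Edge B) v x → x ∈ component B v
    walk⇒∈component = star-closed component-closed (∈-component _)

    module _ (symB : SymmetricAdj B) where

      component-isComponent : ∀ v → IsComponent B (component B v)
      component-isComponent v =
        (v , ∈-component v) ,
        (λ x y x∈ y∈ → edges⇒reach component-closed x∈
           (reverse (edge-sym symB) (component-walk x∈) ◅◅ component-walk y∈)) ,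
        (λ x y x∈ e → component-closed x∈ e)

      ∈-component-sym : ∀ {v x} → x ∈ component B v → v ∈ component B x
      ∈-component-sym x∈ = walk⇒∈component (reverse (edge-sym symB) (component-walk x∈))

      ∈-component-trans : ∀ {u v x} → v ∈ component B u → x ∈ component B v → x ∈ component B u
      ∈-component-trans v∈ x∈ = walk⇒∈component (component-walk v∈ ◅◅ component-walk x∈)

-- Modules and the modular decomposition tree

module _ {n : ℕ} where

  co-≢ : ∀ (A : Adj n) {x y} → x ≢ y → co A x y ≡ not (A x y)
  co-≢ A {x} {y} x≢y with x ≟ y
  ... | yes x≡y = contradiction x≡y x≢y
  ... | no  _   = refl

  co-sym : ∀ {A : Adj n} → SymmetricAdj A → SymmetricAdj (co A)
  co-sym {A} symA x y with x ≟ y | y ≟ x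
  ... | yes _   | yes _   = refl
  ... | yes x≡y | no  y≢x = contradiction (sym x≡y) y≢x
  ... | no  x≢y | yes y≡x = contradiction (sym y≡x) x≢y
  ... | no  _   | no  _   = cong not (symA x y)

  ∈-≢ : ∀ {S : Subset n} {v x} → v ∉ S → x ∈ S → v ≢ x
  ∈-≢ v∉S x∈S refl = v∉S x∈S

  Twins : Adj n → Fin n → Fin n → Set
  Twins A x y = ∀ w → w ≢ x → w ≢ y → A w x ≡ A w y

  module-co : ∀ {A : Adj n} {S} → IsModule A S → IsModule (co A) S
  module-co {A} modS v v∉S x y x∈S y∈S = begin
    co A v x      ≡⟨ co-≢ A (∈-≢ v∉S x∈S) ⟩
    not (A v x)   ≡⟨ cong not (modS v v∉S x y x∈S y∈S) ⟩
    not (A v y)   ≡⟨ sym (co-≢ A (∈-≢ v∉S y∈S)) ⟩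
    co A v y      ∎
    where open ≡-Reasoning

  module-unco : ∀ {A : Adj n} {S} → IsModule (co A) S → IsModule A S
  module-unco {A} modS v v∉S x y x∈S y∈S = not-injective (begin
    not (A v x)   ≡⟨ sym (co-≢ A (∈-≢ v∉S x∈S)) ⟩
    co A v x      ≡⟨ modS v v∉S x y x∈S y∈S ⟩
    co A v y      ≡⟨ co-≢ A (∈-≢ v∉S y∈S) ⟩
    not (A v y)   ∎)
    where open ≡-Reasoning

  module _ {A B : Adj n} (A⇒B : ∀ {S} → IsModule A S → IsModule B S)
                         (B⇒A : ∀ {S} → IsModule B S → IsModule A S) where

    node-transfer : ∀ {M} → IsNode A M → IsNode B M
    node-transfer (nonempty , modM , nested) = nonempty , A⇒B modM , λ M′ modM′ → nested M′ (B⇒A modM′)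

  child-transfer : ∀ {A B : Adj n} →
    (∀ {S} → IsModule A S → IsModule B S) → (∀ {S} → IsModule B S → IsModule A S) →
    ∀ {C M} → IsChild A C M → IsChild B C M
  child-transfer A⇒B B⇒A (nodeM , nodeC , C⊂M , maximal) =
    node-transfer A⇒B B⇒A nodeM , node-transfer A⇒B B⇒A nodeC , C⊂M ,
    λ S nodeS → maximal S (node-transfer B⇒A A⇒B nodeS)

  leafChild-co : ∀ {A : Adj n} {a M} → LeafChildOf A a M → LeafChildOf (co A) a M
  leafChild-co {A} = child-transfer (module-co {A}) (module-unco {A})

  Overlap : Subset n → Subset n → Set
  Overlap N M′ = (∃ λ d → d ∈ N × d ∈ M′) × (∃ λ d → d ∈ N × d ∉ M′) × (∃ λ e → e ∈ M′ × e ∉ N)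

  module _ {A : Adj n} where

    strong-if-no-overlap : ∀ {N} → IsModule A N → (∀ {M′} → IsModule A M′ → ¬ Overlap N M′) →
      IsStrongModule A N
    strong-if-no-overlap {N} modN no-overlap = modN , nested
      where
      nested : ∀ M′ → IsModule A M′ → Disjoint N M′ ⊎ (N ⊆ M′ ⊎ M′ ⊆ N)
      nested M′ modM′ with disjoint-or-meet N M′ | ⊆-or-∉ N M′ | ⊆-or-∉ M′ N
      ... | inj₁ disjoint | _          | _          = inj₁ disjoint
      ... | inj₂ _        | inj₁ N⊆M′ | _          = inj₂ (inj₁ N⊆M′)
      ... | inj₂ _        | inj₂ _     | inj₁ M′⊆N = inj₂ (inj₂ M′⊆N)
      ... | inj₂ meet     | inj₂ out   | inj₂ out′  = contradiction (meet , out , out′) (no-overlap modM′)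

    overlap-⊆-strong : ∀ {M N M′} → IsStrongModule A M → N ⊆ M → IsModule A M′ → Overlap N M′ → M′ ⊆ M
    overlap-⊆-strong {M′ = M′} (_ , nested) N⊆M modM′ ((d , d∈N , d∈M′) , (d′ , d′∈N , d′∉M′) , _)
      with nested M′ modM′
    ... | inj₁ disjoint        = contradiction d∈M′ (disjoint d (N⊆M d∈N))
    ... | inj₂ (inj₁ M⊆M′)    = contradiction (M⊆M′ (N⊆M d′∈N)) d′∉M′
    ... | inj₂ (inj₂ M′⊆M)    = M′⊆M

    ∪-module : ∀ {X Y c} → IsModule A X → IsModule A Y → c ∈ X → c ∈ Y → IsModule A (X ∪ Y)
    ∪-module {X} {Y} {c} modX modY c∈X c∈Y w w∉X∪Y x y x∈ y∈ = trans (to-c x∈) (sym (to-c y∈))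
      where
      to-c : ∀ {z} → z ∈ X ∪ Y → A w z ≡ A w c
      to-c {z} z∈ with x∈p∪q⁻ X Y z∈
      ... | inj₁ z∈X = modX w (λ w∈X → w∉X∪Y (p⊆p∪q Y w∈X)) z c z∈X c∈X
      ... | inj₂ z∈Y = modY w (λ w∈Y → w∉X∪Y (q⊆p∪q X Y w∈Y)) z c z∈Y c∈Y

  module _ {B : Adj n} (symB : SymmetricAdj B) where

    component-of-strong-isStrong : ∀ {M a} → IsStrongModule B M → a ∈ M →
      IsStrongModule B (componentIn B M a)
    component-of-strong-isStrong {M} {a} strongM a∈M = strong-if-no-overlap modD no-overlap
      where
      open Reachable (Within B M) (within? B M) a renaming (set to D)

      D⊆M : D ⊆ M
      D⊆M = componentIn-⊆ a∈M

      modD : IsModule B D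
      modD w w∉D x y x∈D y∈D with w ∈? M
      ... | no  w∉M = proj₁ strongM w w∉M x y (D⊆M x∈D) (D⊆M y∈D)
      ... | yes w∈M = trans (no-edge x∈D) (sym (no-edge y∈D))
        where
        no-edge : ∀ {x} → x ∈ D → B w x ≡ false
        no-edge {x} x∈D with B w x in e
        ... | false = refl
        ... | true  = contradiction (closed x∈D (D⊆M x∈D , w∈M , edge-sym symB e)) w∉D

      no-overlap : ∀ {M′} → IsModule B M′ → ¬ Overlap D M′
      no-overlap {M′} modM′ ov@((d , d∈D , d∈M′) , (d′ , d′∈D , d′∉M′) , (e , e∈M′ , e∉D))
        with crossing (reverse (within-sym symB) (walk d∈D) ◅◅ walk d′∈D) d∈M′ d′∉M′
      ... | u , w , d→u , (u∈M , w∈M , Buw) , u∈M′ , w∉M′ = e∉D (closed w∈D (w∈M , e∈M , Bwe))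
        where
        w∈D : w ∈ D
        w∈D = closed (star-closed closed d∈D d→u) (u∈M , w∈M , Buw)
        e∈M : e ∈ M
        e∈M = overlap-⊆-strong strongM D⊆M modM′ ov e∈M′
        Bwe : B w e ≡ true
        Bwe = trans (modM′ w w∉M′ e u e∈M′ u∈M′) (trans (symB w u) Buw)

    -- Otherwise the B[M]-component of a would be a node strictly between ⁅ a ⁆ and M.
    leafChild-isolated : ∀ {a M v} → LeafChildOf B a M → ¬ Connected B M → v ∈ M → v ≢ a → B a v ≡ false
    leafChild-isolated {a} {M} {v} ((_ , strongM) , _ , (⁅a⁆⊆M , _) , maximal) disconnected v∈M v≢a
      with B a v in e
    ... | false = refl
    ... | true  = contradiction D⊂M (maximal D nodeD ⁅a⁆⊂D)
      where
      open Reachable (Within B M) (within? B M) a renaming (set to D; v∈set to a∈D)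

      a∈M : a ∈ M
      a∈M = ⁅a⁆⊆M (x∈⁅x⁆ a)

      nodeD : IsNode B D
      nodeD = (a , a∈D) , component-of-strong-isStrong strongM a∈M

      ⁅a⁆⊂D : ⁅ a ⁆ ⊂ D
      ⁅a⁆⊂D = ⁅⁆⊆ a∈D , v , closed a∈D (a∈M , v∈M , e) , x≢y⇒x∉⁅y⁆ v≢a

      D⊂M : D ⊂ M
      D⊂M with ⊆-or-∉ M D
      ... | inj₂ (x , x∈M , x∉D) = componentIn-⊆ a∈M , x , x∈M , x∉D
      ... | inj₁ M⊆D = contradiction connected disconnected
        where
        connected : Connected B M
        connected x y x∈M y∈M =
          within⇒reach (reverse (within-sym symB) (walk (M⊆D x∈M)) ◅◅ walk (M⊆D y∈M))

  cut⇒unreachable : ∀ {B : Adj n} {M X : Subset n} →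
    (∀ {u z} → u ∈ M → u ∈ X → z ∈ M → z ∉ X → B u z ≡ false) →
    ∀ {x y} → x ∈ X → y ∉ X → ¬ Reach B M x y
  cut⇒unreachable no-edge x∈X y∉X here = y∉X x∈X
  cut⇒unreachable {X = X} no-edge x∈X y∉X (step {y = z} x∈M z∈M e r) with z ∈? X
  ... | yes z∈X = cut⇒unreachable no-edge z∈X y∉X r
  ... | no  z∉X = true≢false e (no-edge x∈M x∈X z∈M z∉X)

  module _ {A : Adj n} where

    uniform-cut⇒P-or-S : ∀ {M X : Subset n} {x y} κ → x ∈ M → x ∈ X → y ∈ M → y ∉ X →
      (∀ {u z} → u ∈ M → u ∈ X → z ∈ M → z ∉ X → A u z ≡ κ) → LabelP A M ⊎ LabelS A M
    uniform-cut⇒P-or-S false x∈M x∈X y∈M y∉X uniform =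
      inj₁ λ conn → cut⇒unreachable uniform x∈X y∉X (conn _ _ x∈M y∈M)
    uniform-cut⇒P-or-S {M} {X} true x∈M x∈X y∈M y∉X uniform =
      inj₂ λ conn → cut⇒unreachable co-uniform x∈X y∉X (conn _ _ x∈M y∈M)
      where
      co-uniform : ∀ {u z} → u ∈ M → u ∈ X → z ∈ M → z ∉ X → co A u z ≡ false
      co-uniform u∈M u∈X z∈M z∉X =
        trans (co-≢ A (λ u≡z → z∉X (subst (_∈ X) u≡z u∈X))) (cong not (uniform u∈M u∈X z∈M z∉X))

    isModule? : Decidable₁ (IsModule A)
    isModule? M = all? λ v → ¬? (v ∈? M) →-dec all? λ x → all? λ y →
      x ∈? M →-dec y ∈? M →-dec A v x ≟ᵇ A v y

    ProperSubmodule : Subset n → Subset n → Set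
    ProperSubmodule M S = IsModule A S × S ⊂ M

    maximal-proper-submodule : ∀ {M T} → ProperSubmodule M T →
      ∃ λ N → (ProperSubmodule M N × T ⊆ N) × (∀ S → ProperSubmodule M S → ¬ N ⊂ S)
    maximal-proper-submodule {M} {T} properT = grow P Maximal enlarge (properT , λ t∈T → t∈T)
      where
      P : Subset n → Set
      P S = ProperSubmodule M S × T ⊆ S
      Maximal : Subset n → Set
      Maximal N = ∀ S → ProperSubmodule M S → ¬ N ⊂ S
      enlarge : ∀ {S} → P S → Maximal S ⊎ ∃ λ S′ → P S′ × S ⊂ S′
      enlarge {S} (_ , T⊆S) with anySubset? (λ S′ → (isModule? S′ ×-dec S′ ⊂? M) ×-dec S ⊂? S′)
      ... | yes (S′ , properS′ , S⊂S′) = inj₂ (S′ , (properS′ , λ t∈T → proj₁ S⊂S′ (T⊆S t∈T)) , S⊂S′)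
      ... | no  ∄S′ = inj₁ λ S′ properS′ S⊂S′ → ∄S′ (S′ , properS′ , S⊂S′)

    labelN⇒¬P-or-S : ∀ {M} → LabelN A M → ¬ (LabelP A M ⊎ LabelS A M)
    labelN⇒¬P-or-S (¬P , ¬S) (inj₁ P) = ¬P P
    labelN⇒¬P-or-S (¬P , ¬S) (inj₂ S) = ¬S S

    module _ (symA : SymmetricAdj A) where

      maximal-proper-submodule-isStrong : ∀ {M N} → IsStrongModule A M → LabelN A M →
        ProperSubmodule M N → (∀ S → ProperSubmodule M S → ¬ N ⊂ S) → IsStrongModule A N
      maximal-proper-submodule-isStrong {M} {N} strongM labelN (modN , N⊆M , _) maximal =
        strong-if-no-overlap modN no-overlap
        where
        -- A proper N ∪ M′ ⊂ M contradicts maximality; if N ∪ M′ = M, then N and M′ ∖ N split M uniformly.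
        no-overlap : ∀ {M′} → IsModule A M′ → ¬ Overlap N M′
        no-overlap {M′} modM′ ov@((d , d∈N , d∈M′) , (d′ , d′∈N , d′∉M′) , (e , e∈M′ , e∉N))
          with ⊆-or-∉ M (N ∪ M′)
        ... | inj₂ (x , x∈M , x∉N∪M′) =
          maximal (N ∪ M′) (∪-module modN modM′ d∈N d∈M′ , N∪M′⊆M , x , x∈M , x∉N∪M′)
                  (p⊆p∪q M′ , e , q⊆p∪q N M′ e∈M′ , e∉N)
          where
          N∪M′⊆M : N ∪ M′ ⊆ M
          N∪M′⊆M y∈ with x∈p∪q⁻ N M′ y∈
          ... | inj₁ y∈N  = N⊆M y∈N
          ... | inj₂ y∈M′ = overlap-⊆-strong strongM N⊆M modM′ ov y∈M′
        ... | inj₁ M⊆N∪M′ = labelN⇒¬P-or-S labelN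
          (uniform-cut⇒P-or-S (A d′ e) (N⊆M d′∈N) d′∈N (overlap-⊆-strong strongM N⊆M modM′ ov e∈M′) e∉N uniform)
          where
          uniform : ∀ {u z} → u ∈ M → u ∈ N → z ∈ M → z ∉ N → A u z ≡ A d′ e
          uniform {u} {z} _ u∈N z∈M z∉N with x∈p∪q⁻ N M′ (M⊆N∪M′ z∈M)
          ... | inj₁ z∈N  = contradiction z∈N z∉N
          ... | inj₂ z∈M′ = begin
            A u z   ≡⟨ symA u z ⟩
            A z u   ≡⟨ modN z z∉N u d′ u∈N d′∈N ⟩
            A z d′  ≡⟨ symA z d′ ⟩
            A d′ z  ≡⟨ modM′ d′ d′∉M′ z e z∈M′ e∈M′ ⟩
            A d′ e  ∎
            where open ≡-Reasoning

      -- Otherwise M = {q₁, q₂} is labelled P or S, or a maximal proper submodule of M containing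
      -- q₁ and q₂ is a node strictly between ⁅ q₁ ⁆ and M.
      leafChildren-of-N-not-twins : ∀ {M q₁ q₂} → LabelN A M → LeafChildOf A q₁ M → LeafChildOf A q₂ M →
        q₁ ≢ q₂ → ¬ IsModule A (pair q₁ q₂)
      leafChildren-of-N-not-twins {M} {q₁} {q₂} labelN ((_ , strongM) , _ , (⁅q₁⁆⊆M , _) , maximal)
                                  (_ , _ , (⁅q₂⁆⊆M , _) , _) q₁≢q₂ modPair
        with ⊆-or-∉ M (pair q₁ q₂)
      ... | inj₁ M⊆pair = labelN⇒¬P-or-S labelN
        (uniform-cut⇒P-or-S (A q₁ q₂) q₁∈M (x∈⁅x⁆ q₁) q₂∈M q₂∉⁅q₁⁆ uniform)
        where
        q₁∈M : q₁ ∈ M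
        q₁∈M = ⁅q₁⁆⊆M (x∈⁅x⁆ q₁)
        q₂∈M : q₂ ∈ M
        q₂∈M = ⁅q₂⁆⊆M (x∈⁅x⁆ q₂)
        q₂∉⁅q₁⁆ : q₂ ∉ ⁅ q₁ ⁆
        q₂∉⁅q₁⁆ = x≢y⇒x∉⁅y⁆ (λ q₂≡q₁ → q₁≢q₂ (sym q₂≡q₁))
        uniform : ∀ {u z} → u ∈ M → u ∈ ⁅ q₁ ⁆ → z ∈ M → z ∉ ⁅ q₁ ⁆ → A u z ≡ A q₁ q₂
        uniform u∈M u∈⁅q₁⁆ z∈M z∉⁅q₁⁆ with x∈⁅y⁆⇒x≡y q₁ u∈⁅q₁⁆ | ∈-pair⁻ (M⊆pair z∈M)
        ... | refl | inj₁ refl = contradiction (x∈⁅x⁆ q₁) z∉⁅q₁⁆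
        ... | refl | inj₂ refl = refl
      ... | inj₂ (w , w∈M , w∉pair) with maximal-proper-submodule (modPair , pair⊆M , w , w∈M , w∉pair)
        where
        pair⊆M : pair q₁ q₂ ⊆ M
        pair⊆M z∈ with ∈-pair⁻ z∈
        ... | inj₁ refl = ⁅q₁⁆⊆M (x∈⁅x⁆ q₁)
        ... | inj₂ refl = ⁅q₂⁆⊆M (x∈⁅x⁆ q₂)
      ... | N , (properN , pair⊆N) , maximalN = maximal N nodeN ⁅q₁⁆⊂N (proj₂ properN)
        where
        nodeN : IsNode A N
        nodeN = (q₁ , pair⊆N (∈-pairˡ q₁ q₂)) ,
                maximal-proper-submodule-isStrong strongM labelN properN maximalN
        ⁅q₁⁆⊂N : ⁅ q₁ ⁆ ⊂ N
        ⁅q₁⁆⊂N = ⁅⁆⊆ (pair⊆N (∈-pairˡ q₁ q₂)) , q₂ , pair⊆N (∈-pairʳ q₁ q₂) ,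
                 x≢y⇒x∉⁅y⁆ (λ q₂≡q₁ → q₁≢q₂ (sym q₂≡q₁))

    leafChild-∈ : ∀ {a M} → LeafChildOf A a M → a ∈ M
    leafChild-∈ {a} (_ , _ , (⁅a⁆⊆M , _) , _) = ⁅a⁆⊆M (x∈⁅x⁆ a)

    leafChild-other : ∀ {a M} → LeafChildOf A a M → ∃ λ x → x ∈ M × x ≢ a
    leafChild-other (_ , _ , (_ , x , x∈M , x∉⁅a⁆) , _) = x , x∈M , x∉⁅y⁆⇒x≢y x∉⁅a⁆

    pair-module⇒∈parent : ∀ {a b M} → LeafChildOf A a M → IsModule A (pair a b) → b ∈ M
    pair-module⇒∈parent {a} {b} {M} lc@((_ , _ , nested) , _) modPair with nested (pair a b) modPair
    ... | inj₁ disjoint        = contradiction (∈-pairˡ a b) (disjoint a (leafChild-∈ lc))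
    ... | inj₂ (inj₂ pair⊆M)  = pair⊆M (∈-pairʳ a b)
    ... | inj₂ (inj₁ M⊆pair) with leafChild-other lc
    ...   | x , x∈M , x≢a with ∈-pair⁻ (M⊆pair x∈M)
    ...     | inj₁ x≡a = contradiction x≡a x≢a
    ...     | inj₂ refl = x∈M

    node-between-leaf-and-parent : ∀ {q M M′} → LeafChildOf A q M → IsNode A M′ → q ∈ M′ →
      (∃ λ x → x ∈ M′ × x ≢ q) → M′ ⊆ M → M ⊆ M′
    node-between-leaf-and-parent {q} {M} {M′} (_ , _ , _ , maximal) nodeM′ q∈M′ (x , x∈M′ , x≢q) M′⊆M
      with ⊆-or-∉ M M′
    ... | inj₁ M⊆M′ = M⊆M′
    ... | inj₂ (y , y∈M , y∉M′) =
      ⊥-elim (maximal M′ nodeM′ (⁅⁆⊆ q∈M′ , x , x∈M′ , x≢y⇒x∉⁅y⁆ x≢q) (M′⊆M , y , y∈M , y∉M′))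

    parent-has-other : ∀ {a M} → LeafChildOf A a M → ∀ b → ∃ λ x → x ∈ M × x ≢ b
    parent-has-other {a} lc b with a ≟ b
    ... | no  a≢b  = a , leafChild-∈ lc , a≢b
    ... | yes refl = leafChild-other lc

    pair-module-sym : ∀ {a b} → IsModule A (pair a b) → IsModule A (pair b a)
    pair-module-sym {a} {b} = subst (IsModule A) (∪-comm ⁅ a ⁆ ⁅ b ⁆)

    parent-unique : ∀ {q₁ q₂ M₁ M₂} → LeafChildOf A q₁ M₁ → LeafChildOf A q₂ M₂ →
      IsModule A (pair q₁ q₂) → M₁ ≡ M₂
    parent-unique {q₁} {q₂} {M₁} {M₂} lc₁@((_ , _ , nested) , _) lc₂@(nodeM₂ , _) modPair
      with nested M₂ (proj₁ (proj₂ nodeM₂))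
    ... | inj₁ disjoint =
      contradiction (pair-module⇒∈parent lc₂ (pair-module-sym modPair)) (disjoint q₁ (leafChild-∈ lc₁))
    ... | inj₂ (inj₁ M₁⊆M₂) = ⊆-antisym M₁⊆M₂
      (node-between-leaf-and-parent lc₂ (proj₁ lc₁) (pair-module⇒∈parent lc₁ modPair)
         (parent-has-other lc₁ q₂) M₁⊆M₂)
    ... | inj₂ (inj₂ M₂⊆M₁) = ⊆-antisym
      (node-between-leaf-and-parent lc₁ nodeM₂ (pair-module⇒∈parent lc₂ (pair-module-sym modPair))
         (parent-has-other lc₂ q₁) M₂⊆M₁) M₂⊆M₁

    QPart-parent : ∀ {Q q} → IsQPart A Q → q ∈ Q → ∃ λ M → LeafChildOf A q M ×
      ((LabelN A M × Q ≡ ⁅ q ⁆) ⊎ ((LabelP A M ⊎ LabelS A M) × LeafChildrenOf A M Q))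
    QPart-parent (inj₁ (x , M , lc , labelN , refl)) q∈⁅x⁆ with x∈⁅y⁆⇒x≡y x q∈⁅x⁆
    ... | refl = M , lc , inj₁ (labelN , refl)
    QPart-parent (inj₂ (M , label , children@(_ , leaf , _))) q∈Q = M , leaf _ q∈Q , inj₂ (label , children)

    QPart-nonempty : ∀ {Q} → IsQPart A Q → Nonempty Q
    QPart-nonempty (inj₁ (x , _ , _ , _ , refl))               = x , x∈⁅x⁆ x
    QPart-nonempty (inj₂ (_ , _ , (x , lc) , _ , all-leaves)) = x , all-leaves x lc

    twins⇒pair-module : ∀ {x y} → Twins A x y → IsModule A (pair x y)
    twins⇒pair-module {x} {y} twins w w∉pair u z u∈ z∈ with ∈-pair⁻ u∈ | ∈-pair⁻ z∈
    ... | inj₁ refl | inj₁ refl = refl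
    ... | inj₂ refl | inj₂ refl = refl
    ... | inj₁ refl | inj₂ refl = twins w (∈-≢ w∉pair (∈-pairˡ x y)) (∈-≢ w∉pair (∈-pairʳ x y))
    ... | inj₂ refl | inj₁ refl = sym (twins w (∈-≢ w∉pair (∈-pairˡ x y)) (∈-≢ w∉pair (∈-pairʳ x y)))

    module _ (symA : SymmetricAdj A) where

      QPart-≡-of-twins : ∀ {Q₁ Q₂ q₁ q₂} → IsQPart A Q₁ → IsQPart A Q₂ → q₁ ∈ Q₁ → q₂ ∈ Q₂ →
        Twins A q₁ q₂ → Q₁ ≡ Q₂
      QPart-≡-of-twins {q₁ = q₁} {q₂} part₁ part₂ q₁∈Q₁ q₂∈Q₂ twins
        with QPart-parent part₁ q₁∈Q₁ | QPart-parent part₂ q₂∈Q₂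
      ... | M₁ , lc₁ , origin₁ | M₂ , lc₂ , origin₂ with parent-unique lc₁ lc₂ (twins⇒pair-module twins)
      ... | refl with origin₁ | origin₂
      ... | inj₁ (labelN , refl) | inj₁ (_ , refl) with q₁ ≟ q₂
      ...   | yes refl  = refl
      ...   | no  q₁≢q₂ =
        ⊥-elim (leafChildren-of-N-not-twins symA labelN lc₁ lc₂ q₁≢q₂ (twins⇒pair-module twins))
      QPart-≡-of-twins _ _ _ _ _ | _ | _ | refl | inj₁ (labelN , _) | inj₂ (label , _) =
        ⊥-elim (labelN⇒¬P-or-S labelN label)
      QPart-≡-of-twins _ _ _ _ _ | _ | _ | refl | inj₂ (label , _) | inj₁ (labelN , _) =
        ⊥-elim (labelN⇒¬P-or-S labelN label)
      QPart-≡-of-twins _ _ _ _ _ | _ | _ | refl | inj₂ (_ , (_ , leaf₁ , all₁))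
                                                     | inj₂ (_ , (_ , leaf₂ , all₂)) =
        ⊆-antisym (λ {y} y∈ → all₂ y (leaf₁ y y∈)) (λ {y} y∈ → all₁ y (leaf₂ y y∈))

      QPart-≡-of-shared : ∀ {Q₁ Q₂ q} → IsQPart A Q₁ → IsQPart A Q₂ → q ∈ Q₁ → q ∈ Q₂ → Q₁ ≡ Q₂
      QPart-≡-of-shared part₁ part₂ q∈Q₁ q∈Q₂ = QPart-≡-of-twins part₁ part₂ q∈Q₁ q∈Q₂ (λ _ _ _ → refl)

      leafChild-in-P : ∀ {a M v} → LeafChildOf A a M → LabelP A M → v ∈ M → v ≢ a → A a v ≡ false
      leafChild-in-P = leafChild-isolated symA

      leafChild-in-S : ∀ {a M v} → LeafChildOf A a M → LabelS A M → v ∈ M → v ≢ a → A a v ≡ true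
      leafChild-in-S {a} {M} {v} lc labelS v∈M v≢a = not-injective (begin
        not (A a v)  ≡⟨ sym (co-≢ A (λ a≡v → v≢a (sym a≡v))) ⟩
        co A a v     ≡⟨ leafChild-isolated (co-sym symA) (leafChild-co lc) labelS v∈M v≢a ⟩
        false        ∎)
        where open ≡-Reasoning

      leafChildren-uniform : ∀ {M P w x y} → LeafChildrenOf A M P → LabelP A M ⊎ LabelS A M →
        w ∈ M → w ∉ P → x ∈ P → y ∈ P → A x w ≡ A y w
      leafChildren-uniform (_ , leaf , _) (inj₁ labelP) w∈M w∉P x∈P y∈P =
        trans (leafChild-in-P (leaf _ x∈P) labelP w∈M (∈-≢ w∉P x∈P))
              (sym (leafChild-in-P (leaf _ y∈P) labelP w∈M (∈-≢ w∉P y∈P)))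
      leafChildren-uniform (_ , leaf , _) (inj₂ labelS) w∈M w∉P x∈P y∈P =
        trans (leafChild-in-S (leaf _ x∈P) labelS w∈M (∈-≢ w∉P x∈P))
              (sym (leafChild-in-S (leaf _ y∈P) labelS w∈M (∈-≢ w∉P y∈P)))

      leafChildren-module : ∀ {M P} → LeafChildrenOf A M P → LabelP A M ⊎ LabelS A M → IsModule A P
      leafChildren-module {M} children@(_ , leaf , _) label w w∉P x y x∈P y∈P with w ∈? M
      ... | yes w∈M = trans (symA w x) (trans (leafChildren-uniform children label w∈M w∉P x∈P y∈P) (symA y w))
      ... | no  w∉M = let ((_ , modM , _) , _) = leaf x x∈P in
        modM w w∉M x y (leafChild-∈ (leaf x x∈P)) (leafChild-∈ (leaf y y∈P))

      PVertex-module : ∀ {Q} → IsPVertex A Q → IsModule A Q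
      PVertex-module (_ , _ , _ , labelP , children) = leafChildren-module children (inj₁ labelP)

      SVertex-module : ∀ {Q} → IsSVertex A Q → IsModule A Q
      SVertex-module (_ , _ , _ , labelS , children) = leafChildren-module children (inj₂ labelS)

      PVertex-independent : ∀ {Q x y} → IsPVertex A Q → x ∈ Q → y ∈ Q → x ≢ y → A x y ≡ false
      PVertex-independent (_ , _ , _ , labelP , (_ , leaf , _)) x∈Q y∈Q x≢y =
        leafChild-in-P (leaf _ x∈Q) labelP (leafChild-∈ (leaf _ y∈Q)) (λ y≡x → x≢y (sym y≡x))

      SVertex-clique : ∀ {Q x y} → IsSVertex A Q → x ∈ Q → y ∈ Q → x ≢ y → A x y ≡ true
      SVertex-clique (_ , _ , _ , labelS , (_ , leaf , _)) x∈Q y∈Q x≢y =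
        leafChild-in-S (leaf _ x∈Q) labelS (leafChild-∈ (leaf _ y∈Q)) (λ y≡x → x≢y (sym y≡x))

-- Edition sets

module _ {n : ℕ} where

  Touched : List (Fin n × Fin n) → Fin n → Set
  Touched F x = ∃ λ w → inF F x w ≡ true

  touched? : ∀ F → Decidable₁ (Touched F)
  touched? F x = any? λ w → inF F x w ≟ᵇ true

  endpoints : List (Fin n × Fin n) → List (Fin n)
  endpoints F = map proj₁ F ++ map proj₂ F

  length-endpoints : ∀ (F : List (Fin n × Fin n)) → length (endpoints F) ≡ length F + length F
  length-endpoints F = trans (length-++ (map proj₁ F)) (cong₂ _+_ (length-map proj₁ F) (length-map proj₂ F))

  inF-sym : ∀ (F : List (Fin n × Fin n)) x y → inF F x y ≡ inF F y x
  inF-sym []            x y = refl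
  inF-sym ((a , b) ∷ F) x y = cong₂ _∨_ (∨-comm (⌊ a ≟ x ⌋ ∧ ⌊ b ≟ y ⌋) (⌊ a ≟ y ⌋ ∧ ⌊ b ≟ x ⌋)) (inF-sym F x y)

  private
    both-≡ : ∀ {a b x y : Fin n} → T (⌊ a ≟ x ⌋ ∧ ⌊ b ≟ y ⌋) → a ≡ x × b ≡ y
    both-≡ {a} {b} {x} {y} t =
      let (t₁ , t₂) = Equivalence.to (T-∧ {⌊ a ≟ x ⌋} {⌊ b ≟ y ⌋}) t in toWitness t₁ , toWitness t₂

  inF⇒∈ : ∀ (F : List (Fin n × Fin n)) {x y} → inF F x y ≡ true →
    ∃ λ p → p ∈ₗ F × ((proj₁ p ≡ x × proj₂ p ≡ y) ⊎ (proj₁ p ≡ y × proj₂ p ≡ x))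
  inF⇒∈ F e with find (any⁻ _ F (Equivalence.from T-≡ e))
  ... | p , p∈F , match with Equivalence.to T-∨ match
  ...   | inj₁ t = p , p∈F , inj₁ (both-≡ t)
  ...   | inj₂ t = p , p∈F , inj₂ (both-≡ t)

  inF⇒∈endpoints : ∀ (F : List (Fin n × Fin n)) {x y} → inF F x y ≡ true → x ∈ₗ endpoints F
  inF⇒∈endpoints F e with inF⇒∈ F e
  ... | p , p∈F , inj₁ (refl , _) = ∈-++⁺ˡ (∈-map⁺ proj₁ p∈F)
  ... | p , p∈F , inj₂ (_ , refl) = ∈-++⁺ʳ (map proj₁ F) (∈-map⁺ proj₂ p∈F)

  inF-irrefl : ∀ {F : List (Fin n × Fin n)} → IsEditionSet F → ∀ x → inF F x x ≡ false
  inF-irrefl {F} (ordered , _) x = ¬-not λ e → contradiction (inF⇒∈ F e) λ where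
    (_ , p∈F , inj₁ (refl , p₂≡x)) → <-irrefl (sym p₂≡x) (All.lookup ordered p∈F)
    (_ , p∈F , inj₂ (refl , p₂≡x)) → <-irrefl (sym p₂≡x) (All.lookup ordered p∈F)

  edit-untouched : ∀ {A : Adj n} {F x} → ¬ Touched F x → ∀ w → edit A F x w ≡ A x w
  edit-untouched {A} {F} {x} untouched w with inF F x w in e
  ... | true  = contradiction (w , e) untouched
  ... | false = xor-identityʳ (A x w)

  edit-pair : ∀ {A : Adj n} {F x w} → inF F x w ≡ true → edit A F x w ≡ not (A x w)
  edit-pair {A} {F} {x} {w} e rewrite e = xor-comm (A x w) true

-- Components of L_ℓ-cluster graphs

module _ {n : ℕ} {A B : Adj n} {C : Subset n} (agree : ∀ {x} → x ∈ C → ∀ y → A x y ≡ B x y) where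

  reach-agree : ∀ {x y} → Reach A C x y → Reach B C x y
  reach-agree here                   = here
  reach-agree (step x∈C y∈C e r) = step x∈C y∈C (trans (sym (agree x∈C _)) e) (reach-agree r)

  isComponent-agree : IsComponent A C → IsComponent B C
  isComponent-agree (nonempty , connected , closedC) =
    nonempty , (λ x y x∈C y∈C → reach-agree (connected x y x∈C y∈C)) ,
    λ x y x∈C e → closedC x y x∈C (trans (agree x∈C y) e)

  isCliqueOn-agree : IsCliqueOn A C → IsCliqueOn B C
  isCliqueOn-agree clique x y x∈C y∈C x≢y = trans (sym (agree x∈C y)) (clique x y x∈C y∈C x≢y)

  isLCliqueOn-agree : ∀ {ℓ} → IsLCliqueOn ℓ A C → IsLCliqueOn ℓ B C
  isLCliqueOn-agree (connected , c , onto , coloured) =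
    (λ x y x∈C y∈C → reach-agree (connected x y x∈C y∈C)) , c , onto ,
    λ x y x∈C y∈C → (λ e → proj₁ (coloured x y x∈C y∈C) (trans (agree x∈C y) e)) ,
                    (λ c≢ → trans (sym (agree x∈C y)) (proj₂ (coloured x y x∈C y∈C) c≢))

another-element : ∀ {k} → 2 ≤ k → (i : Fin k) → ∃ λ j → j ≢ i
another-element (s≤s (s≤s _)) Fin.zero    = Fin.suc Fin.zero , λ ()
another-element (s≤s (s≤s _)) (Fin.suc _) = Fin.zero , λ ()

module _ {n : ℕ} {B : Adj n} {C : Subset n} where

  clique-nonadjacent⇒≡ : IsCliqueOn B C → ∀ {x y} → x ∈ C → y ∈ C → B x y ≡ false → x ≡ y
  clique-nonadjacent⇒≡ clique {x} {y} x∈C y∈C e with x ≟ y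
  ... | yes x≡y = x≡y
  ... | no  x≢y = ⊥-elim (true≢false (clique x y x∈C y∈C x≢y) e)

module _ {n ℓ : ℕ} {B : Adj n} {C : Subset n} where

  ClusterShape : Set
  ClusterShape = IsCliqueOn B C ⊎ IsLCliqueOn ℓ B C

  colouring : IsLCliqueOn ℓ B C → Fin n → Fin ℓ
  colouring (_ , c , _) = c

  nonadjacent⇒same-colour : (lclique : IsLCliqueOn ℓ B C) → ∀ {x y} → x ∈ C → y ∈ C →
    B x y ≡ false → colouring lclique x ≡ colouring lclique y
  nonadjacent⇒same-colour (_ , c , _ , coloured) {x} {y} x∈C y∈C e with c x ≟ c y
  ... | yes same = same
  ... | no  diff = ⊥-elim (true≢false (proj₂ (coloured x y x∈C y∈C) diff) e)

  same-colour⇒nonadjacent : (lclique : IsLCliqueOn ℓ B C) → ∀ {x y} → x ∈ C → y ∈ C →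
    colouring lclique x ≡ colouring lclique y → B x y ≡ false
  same-colour⇒nonadjacent (_ , c , _ , coloured) {x} {y} x∈C y∈C same =
    ¬-not λ e → proj₁ (coloured x y x∈C y∈C) e same

  lclique-neighbour : IsLCliqueOn ℓ B C → 2 ≤ ℓ → ∀ {x} → x ∈ C → ∃ λ u → u ∈ C × B x u ≡ true
  lclique-neighbour (_ , c , onto , coloured) 2≤ℓ {x} x∈C with another-element 2≤ℓ (c x)
  ... | j , j≢cx with onto j
  ...   | u , u∈C , cu≡j =
    u , u∈C , proj₂ (coloured x u x∈C u∈C) λ cx≡cu → j≢cx (trans (sym cu≡j) (sym cx≡cu))

  nonadjacent-trans : ClusterShape → ∀ {a b c} → a ∈ C → b ∈ C → c ∈ C →
    B a b ≡ false → B b c ≡ false → B a c ≡ false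
  nonadjacent-trans (inj₁ clique) a∈C b∈C c∈C ab bc with clique-nonadjacent⇒≡ clique a∈C b∈C ab
  ... | refl = bc
  nonadjacent-trans (inj₂ lclique) a∈C b∈C c∈C ab bc = same-colour⇒nonadjacent lclique a∈C c∈C
    (trans (nonadjacent⇒same-colour lclique a∈C b∈C ab) (nonadjacent⇒same-colour lclique b∈C c∈C bc))

  colour : Fin ℓ → ClusterShape → Fin n → Fin ℓ
  colour c₀ (inj₁ _)       = λ _ → c₀
  colour c₀ (inj₂ lclique) = colouring lclique

  non-clique-same-colour⇒nonadjacent : ∀ c₀ (shape : ClusterShape) → ¬ IsCliqueOn B C → ∀ {x y} →
    x ∈ C → y ∈ C → colour c₀ shape x ≡ colour c₀ shape y → B x y ≡ false
  non-clique-same-colour⇒nonadjacent c₀ (inj₁ clique)  not-clique = ⊥-elim (not-clique clique)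
  non-clique-same-colour⇒nonadjacent c₀ (inj₂ lclique) _          = same-colour⇒nonadjacent lclique

  module _ (symB : SymmetricAdj B) (closedC : ∀ x y → x ∈ C → B x y ≡ true → y ∈ C) where

    nonadjacent⇒same-neighbours : ClusterShape → ∀ {a b} → a ∈ C → b ∈ C → B a b ≡ false →
      ∀ w → B a w ≡ B b w
    nonadjacent⇒same-neighbours shape {a} {b} a∈C b∈C ab w with B a w in aw | B b w in bw
    ... | true  | true  = refl
    ... | false | false = refl
    ... | true  | false =
      ⊥-elim (true≢false aw (nonadjacent-trans shape a∈C b∈C (closedC a w a∈C aw) ab bw))
    ... | false | true  =
      ⊥-elim (true≢false bw (nonadjacent-trans shape b∈C a∈C (closedC b w b∈C bw) (trans (symB b a) ab) aw))

    same-colour⇒twins : ∀ c₀ (shape : ClusterShape) {a b} → a ∈ C → b ∈ C →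
      colour c₀ shape a ≡ colour c₀ shape b → Twins B a b
    same-colour⇒twins c₀ (inj₁ clique) {a} {b} a∈C b∈C _ w w≢a w≢b with w ∈? C
    ... | yes w∈C = trans (clique w a w∈C a∈C w≢a) (sym (clique w b w∈C b∈C w≢b))
    ... | no  w∉C = trans (symB w a) (trans (outside a∈C) (sym (trans (symB w b) (outside b∈C))))
      where
      outside : ∀ {x} → x ∈ C → B x w ≡ false
      outside {x} x∈C = ¬-not λ e → w∉C (closedC x w x∈C e)
    same-colour⇒twins c₀ shape@(inj₂ lclique) {a} {b} a∈C b∈C same w _ _ =
      trans (symB w a) (trans (nonadjacent⇒same-neighbours shape a∈C b∈C
        (same-colour⇒nonadjacent lclique a∈C b∈C same) w) (symB b w))

module _ {n : ℕ} {B : Adj n} where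

  isolated⇒clique-component : ∀ {q} → (∀ w → B q w ≡ false) → IsComponent B ⁅ q ⁆ × IsCliqueOn B ⁅ q ⁆
  isolated⇒clique-component {q} isolated =
    ((q , x∈⁅x⁆ q) , connected , closed) ,
    λ x y x∈ y∈ x≢y → contradiction (trans (x∈⁅y⁆⇒x≡y q x∈) (sym (x∈⁅y⁆⇒x≡y q y∈))) x≢y
    where
    connected : Connected B ⁅ q ⁆
    connected x y x∈ y∈ rewrite x∈⁅y⁆⇒x≡y q x∈ | x∈⁅y⁆⇒x≡y q y∈ = here
    closed : ∀ x y → x ∈ ⁅ q ⁆ → B x y ≡ true → y ∈ ⁅ q ⁆
    closed x y x∈ e rewrite x∈⁅y⁆⇒x≡y q x∈ = ⊥-elim (true≢false e (isolated y))

-- Charging the parts of the Q-partition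

module ClusterEditing {n : ℕ} (ℓ : ℕ) (2≤ℓ : 2 ≤ ℓ) (G : Graph n)
  (no-cluster-component : ∀ (C : Subset n) → IsComponent (adj G) C →
                          ¬ IsCliqueOn (adj G) C × ¬ IsLCliqueOn ℓ (adj G) C)
  (F : List (Fin n × Fin n)) (F-edition : IsEditionSet F)
  (cluster : IsLCluster ℓ (edit (adj G) F)) where

  A : Adj n
  A = adj G

  H : Adj n
  H = edit A F

  symA : SymmetricAdj A
  symA = Graph.sym G

  symH : SymmetricAdj H
  symH x y = cong₂ _xor_ (symA x y) (inF-sym F x y)

  Untouched : Fin n → Set
  Untouched x = ¬ Touched F x

  H≡A : ∀ {x} → Untouched x → ∀ w → H x w ≡ A x w
  H≡A = edit-untouched {A = A} {F}

  H≡Aʳ : ∀ {x} → Untouched x → ∀ w → H w x ≡ A w x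
  H≡Aʳ {x} untouched w = trans (symH w x) (trans (H≡A untouched w) (symA x w))

  H-edited : ∀ {x w} → inF F x w ≡ true → H x w ≡ not (A x w)
  H-edited = edit-pair {A = A} {F}

  differs⇒touched : ∀ {x w} → H x w ≢ A x w → Touched F x
  differs⇒touched {x} {w} H≢A = decidable-stable (touched? F x) λ untouched → H≢A (H≡A untouched w)

  untouched-twins : ∀ {x y} → Untouched x → Untouched y → Twins H x y → Twins A x y
  untouched-twins ux uy twins w w≢x w≢y = trans (sym (H≡Aʳ ux w)) (trans (twins w w≢x w≢y) (H≡Aʳ uy w))

  Hcomp : Fin n → Subset n
  Hcomp = component H

  Hcomp-closed : ∀ v x y → x ∈ Hcomp v → H x y ≡ true → y ∈ Hcomp v
  Hcomp-closed v x y x∈ e = component-closed x∈ e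

  shape : ∀ v → ClusterShape {ℓ = ℓ} {H} {Hcomp v}
  shape v = cluster (Hcomp v) (component-isComponent symH v)

  colourIn : Fin n → Fin n → Fin ℓ
  colourIn v = colour (fromℕ< (≤-trans (s≤s z≤n) 2≤ℓ)) (shape v)

  Hcomp-outside : ∀ {v x w} → x ∈ Hcomp v → w ∉ Hcomp v → H x w ≡ false
  Hcomp-outside {v} {x} {w} x∈ w∉ = ¬-not λ e → w∉ (Hcomp-closed v x w x∈ e)

  component-has-touched : ∀ v → ∃ λ x → x ∈ Hcomp v × Touched F x
  component-has-touched v with any? (λ x → x ∈? Hcomp v ×-dec touched? F x)
  ... | yes found = found
  ... | no  ∄touched = ⊥-elim
    ([ proj₁ G-cluster ∘ isCliqueOn-agree agree , proj₂ G-cluster ∘ isLCliqueOn-agree agree ] (shape v))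
    where
    agree : ∀ {x} → x ∈ Hcomp v → ∀ y → H x y ≡ A x y
    agree x∈ = H≡A λ touched → ∄touched (_ , x∈ , touched)
    G-cluster : ¬ IsCliqueOn A (Hcomp v) × ¬ IsLCliqueOn ℓ A (Hcomp v)
    G-cluster = no-cluster-component (Hcomp v) (isComponent-agree agree (component-isComponent symH v))

  has-neighbour : ∀ q → ∃ λ w → A q w ≡ true
  has-neighbour q with any? (λ w → A q w ≟ᵇ true)
  ... | yes found = found
  ... | no  ∄nbr  =
    let (isolated , clique) = isolated⇒clique-component λ w → ¬-not λ e → ∄nbr (w , e)
    in ⊥-elim (proj₁ (no-cluster-component ⁅ q ⁆ isolated) clique)

  E : List (Fin n)
  E = endpoints F

  touched⇒∈E : ∀ {x} → Touched F x → x ∈ₗ E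
  touched⇒∈E (_ , e) = inF⇒∈endpoints F e

  same-colour⇒same-part : ∀ {Q₁ Q₂ q₁ q₂ x} → IsQPart A Q₁ → IsQPart A Q₂ → q₁ ∈ Q₁ → q₂ ∈ Q₂ →
    Untouched q₁ → Untouched q₂ → q₁ ∈ Hcomp x → q₂ ∈ Hcomp x → colourIn x q₁ ≡ colourIn x q₂ → Q₁ ≡ Q₂
  same-colour⇒same-part {x = x} part₁ part₂ q₁∈Q₁ q₂∈Q₂ u₁ u₂ q₁∈ q₂∈ same =
    QPart-≡-of-twins symA part₁ part₂ q₁∈Q₁ q₂∈Q₂
      (untouched-twins u₁ u₂ (same-colour⇒twins symH (Hcomp-closed x) _ (shape x) q₁∈ q₂∈ same))

  module QPartBound where

    Token : Set
    Token = Fin n ⊎ (Fin n × Fin ℓ)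

    tokens : List Token
    tokens = map inj₁ E ++ map inj₂ (cartesianProduct E (allFin ℓ))

    data Charge (Q : Subset n) : Token → Set where
      member    : ∀ {x} → x ∈ Q → Touched F x → Charge Q (inj₁ x)
      coloured  : ∀ {x q i} → q ∈ Q → Untouched q → q ∈ Hcomp x → Touched F x →
                  colourIn x q ≡ i → Charge Q (inj₂ (x , i))

    charge : ∀ {Q} → IsQPart A Q → ∃ (Charge Q)
    charge {Q} part with any? (λ x → x ∈? Q ×-dec touched? F x)
    ... | yes (x , x∈Q , touched) = inj₁ x , member x∈Q touched
    ... | no  ∄touched with QPart-nonempty part
    ...   | q , q∈Q with component-has-touched q
    ...     | x , x∈ , touched = inj₂ (x , colourIn x q) ,
      coloured q∈Q (λ t → ∄touched (q , q∈Q , t)) (∈-component-sym symH x∈) touched refl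

    charge-∈ : ∀ {Q t} → Charge Q t → t ∈ₗ tokens
    charge-∈ (member _ touched) = ∈-++⁺ˡ (∈-map⁺ inj₁ (touched⇒∈E touched))
    charge-∈ (coloured _ _ _ touched refl) =
      ∈-++⁺ʳ (map inj₁ E) (∈-map⁺ inj₂ (∈-cartesianProduct⁺ (touched⇒∈E touched) (∈-allFin _)))

    charge-injective : ∀ {Q₁ Q₂ t} → IsQPart A Q₁ → IsQPart A Q₂ → Charge Q₁ t → Charge Q₂ t → Q₁ ≡ Q₂
    charge-injective part₁ part₂ (member x∈Q₁ _) (member x∈Q₂ _) = QPart-≡-of-shared symA part₁ part₂ x∈Q₁ x∈Q₂
    charge-injective part₁ part₂ (coloured q₁∈ u₁ c₁ _ refl) (coloured q₂∈ u₂ c₂ _ same) =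
      same-colour⇒same-part part₁ part₂ q₁∈ q₂∈ u₁ u₂ c₁ c₂ (sym same)

    length-tokens : length tokens ≡ length E + length E * ℓ
    length-tokens = begin
      length tokens
        ≡⟨ length-++ (map inj₁ E) ⟩
      length (map inj₁ E) + length (map inj₂ (cartesianProduct E (allFin ℓ)))
        ≡⟨ cong₂ _+_ (length-map inj₁ E) (length-map inj₂ (cartesianProduct E (allFin ℓ))) ⟩
      length E + length (cartesianProduct E (allFin ℓ))
        ≡⟨ cong (length E +_) (length-cartesianProduct E (allFin ℓ)) ⟩
      length E + length E * length (allFin ℓ)
        ≡⟨ cong (λ m → length E + length E * m) (length-allFin ℓ) ⟩
      length E + length E * ℓ
        ∎
      where open ≡-Reasoning

    bound : AtMost (length E + length E * ℓ) (IsQPart A)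
    bound L unique parts = subst (length L ≤_) length-tokens
      (length-≤-of-injective-charge Charge unique
        (λ Q∈L → let (t , c) = charge (All.lookup parts Q∈L) in t , charge-∈ c , c)
        (λ Q₁∈L Q₂∈L → charge-injective (All.lookup parts Q₁∈L) (All.lookup parts Q₂∈L)))

  -- Charges of untouched P- and S-vertices avoid the designated vertices of the touched ones.
  designated : Subset n → Maybe (Fin n)
  designated Q with any? (λ x → x ∈? Q ×-dec touched? F x)
  ... | yes (x , _) = just x
  ... | no  _       = nothing

  designated-just : ∀ {Q x} → designated Q ≡ just x → x ∈ Q × Touched F x
  designated-just {Q} e with any? (λ x → x ∈? Q ×-dec touched? F x)
  designated-just refl | yes (_ , x∈Q , touched) = x∈Q , touched

  designated-nothing : ∀ {Q x} → designated Q ≡ nothing → x ∈ Q → Untouched x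
  designated-nothing {Q} e x∈Q touched with any? (λ x → x ∈? Q ×-dec touched? F x)
  designated-nothing () x∈Q touched | yes _
  designated-nothing e  x∈Q touched | no ∄touched = ∄touched (_ , x∈Q , touched)

  module Designation (L : List (Subset n)) (parts : ∀ {Q} → Q ∈ₗ L → IsQPart A Q) where

    DesignatedIn : Fin n → Set
    DesignatedIn x = Any (λ Q → designated Q ≡ just x) L

    designatedIn? : Decidable₁ DesignatedIn
    designatedIn? x = Any.any? (λ Q → ≡-dec-Maybe _≟_ (designated Q) (just x)) L

    designated-unique : ∀ {Q x y} → Q ∈ₗ L → designated Q ≡ just x → y ∈ Q → DesignatedIn y → y ≡ x
    designated-unique Q∈L dQ y∈Q designatedY with find designatedY
    ... | Q′ , Q′∈L , dQ′ with QPart-≡-of-shared symA (parts Q′∈L) (parts Q∈L) (proj₁ (designated-just dQ′)) y∈Q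
    ...   | refl = just-injective (trans (sym dQ′) dQ)

  Universal : Fin n → Set
  Universal q = ∀ w → w ∈ Hcomp q → w ≢ q → H q w ≡ true

  universal⇒twins : ∀ {q₁ q₂} → q₂ ∈ Hcomp q₁ → Universal q₁ → Universal q₂ → Twins H q₁ q₂
  universal⇒twins {q₁} {q₂} q₂∈ univ₁ univ₂ w w≢q₁ w≢q₂ with w ∈? Hcomp q₁
  ... | yes w∈ = trans (symH w q₁) (trans (univ₁ w w∈ w≢q₁) (sym (trans (symH w q₂) (univ₂ w w∈′ w≢q₂))))
    where
    w∈′ : w ∈ Hcomp q₂
    w∈′ = ∈-component-trans symH (∈-component-sym symH q₂∈) w∈
  ... | no  w∉ = trans (symH w q₁) (trans (Hcomp-outside (∈-component q₁) w∉)
                   (sym (trans (symH w q₂) (Hcomp-outside q₂∈ w∉))))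

  universal-or-non-neighbour : ∀ {q y} → y ∈ Hcomp q →
    Universal y ⊎ ∃ λ z → z ∈ Hcomp q × z ≢ y × H y z ≡ false
  universal-or-non-neighbour {q} {y} y∈ with any? (λ z → z ∈? Hcomp q ×-dec ¬? (z ≟ y) ×-dec H y z ≟ᵇ false)
  ... | yes found = inj₂ found
  ... | no  ∄z    = inj₁ λ w w∈ w≢y → ¬-not λ yw → ∄z (w , ∈-component-trans symH y∈ w∈ , w≢y , yw)

  untouched-SVertex-universal : ∀ {Q q} → IsSVertex A Q → (∀ {z} → z ∈ Q → Untouched z) → q ∈ Q → Universal q
  untouched-SVertex-universal {Q} {q} sQ untouched q∈Q w w∈ w≢q = ¬-not λ qw →
    let (q′ , q′∈Q , q′≢q) = ∃-other (proj₁ (proj₂ sQ)) q∈Q in non-neighbour-impossible q′∈Q q′≢q qw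
    where
    non-neighbour-impossible : ∀ {q′} → q′ ∈ Q → q′ ≢ q → H q w ≡ false → ⊥
    non-neighbour-impossible {q′} q′∈Q q′≢q qw =
      true≢false Hqq′ (nonadjacent-trans (shape q) (∈-component q) w∈ q′∈ qw wq′)
      where
      Hqq′ : H q q′ ≡ true
      Hqq′ = trans (H≡A (untouched q∈Q) q′) (SVertex-clique symA sQ q∈Q q′∈Q (λ q≡q′ → q′≢q (sym q≡q′)))
      q′∈ : q′ ∈ Hcomp q
      q′∈ = Hcomp-closed q q q′ (∈-component q) Hqq′
      w∉Q : w ∉ Q
      w∉Q w∈Q = true≢false
        (trans (H≡A (untouched q∈Q) w) (SVertex-clique symA sQ q∈Q w∈Q (λ q≡w → w≢q (sym q≡w)))) qw
      wq′ : H w q′ ≡ false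
      wq′ = begin
        H w q′  ≡⟨ H≡Aʳ (untouched q′∈Q) w ⟩
        A w q′  ≡⟨ SVertex-module symA sQ w w∉Q q′ q q′∈Q q∈Q ⟩
        A w q   ≡⟨ sym (H≡Aʳ (untouched q∈Q) w) ⟩
        H w q   ≡⟨ symH w q ⟩
        H q w   ≡⟨ qw ⟩
        false   ∎
        where open ≡-Reasoning

  part-meeting-universal-⊆ : ∀ {Q q Q* z} → IsQPart A Q → (∀ {z} → z ∈ Q → Untouched z) → q ∈ Q →
    Universal q → IsQPart A Q* → IsModule A Q* → z ∈ Q* → z ∈ Hcomp q → Touched F z → Q* ⊆ Hcomp q
  part-meeting-universal-⊆ {Q} {q} {Q*} {z} part untouched q∈Q univ part* mod* z∈Q* z∈ touched {u} u∈Q* =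
    Hcomp-closed q q u (∈-component q) (begin
      H q u  ≡⟨ H≡A (untouched q∈Q) u ⟩
      A q u  ≡⟨ mod* q q∉Q* u z u∈Q* z∈Q* ⟩
      A q z  ≡⟨ sym (H≡A (untouched q∈Q) z) ⟩
      H q z  ≡⟨ univ z z∈ z≢q ⟩
      true   ∎)
    where
    open ≡-Reasoning
    q∉Q* : q ∉ Q*
    q∉Q* q∈Q* = untouched (subst (z ∈_) (QPart-≡-of-shared symA part* part q∈Q* q∈Q) z∈Q*) touched
    z≢q : z ≢ q
    z≢q refl = untouched q∈Q touched

  module SVertexBound (L : List (Subset n)) (svertices : All (IsSVertex A) L) where

    sv : ∀ {Q} → Q ∈ₗ L → IsSVertex A Q
    sv = All.lookup svertices

    open Designation L (proj₁ ∘ sv)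

    module _ {Q q} (sQ : IsSVertex A Q) (untouched : ∀ {z} → z ∈ Q → Untouched z) (q∈Q : q ∈ Q)
             (all-designated : ∀ {x} → x ∈ Hcomp q → Touched F x → DesignatedIn x) where

      private
        univ : Universal q
        univ = untouched-SVertex-universal sQ untouched q∈Q

      designated-part : ∀ {x} → x ∈ Hcomp q → Touched F x → ∃ λ Q′ → Q′ ∈ₗ L × designated Q′ ≡ just x
      designated-part x∈ touched = find (all-designated x∈ touched)

      partner : ∀ {Q′ x} → Q′ ∈ₗ L → designated Q′ ≡ just x → x ∈ Hcomp q →
        ∃ λ y → y ∈ Q′ × y ≢ x × y ∈ Hcomp q × Untouched y
      partner {Q′} {x} Q′∈L dQ′ x∈ with designated-just dQ′
      ... | x∈Q′ , touched with ∃-other (proj₁ (proj₂ (sv Q′∈L))) x∈Q′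
      ...   | y , y∈Q′ , y≢x = y , y∈Q′ , y≢x , y∈ ,
                                λ ty → y≢x (designated-unique Q′∈L dQ′ y∈Q′ (all-designated y∈ ty))
        where
        y∈ : y ∈ Hcomp q
        y∈ = part-meeting-universal-⊆ (proj₁ sQ) untouched q∈Q univ (proj₁ (sv Q′∈L))
               (SVertex-module symA (sv Q′∈L)) x∈Q′ x∈ touched y∈Q′

      module _ {Q′ x₀ y z} (Q′∈L : Q′ ∈ₗ L) (dQ′ : designated Q′ ≡ just x₀) (x₀∈ : x₀ ∈ Hcomp q)
               (y∈Q′ : y ∈ Q′) (y≢x₀ : y ≢ x₀) (y∈ : y ∈ Hcomp q) (uy : Untouched y)
               (z∈ : z ∈ Hcomp q) (z≢y : z ≢ y) (yz : H y z ≡ false) where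

        private
          sQ′ : IsSVertex A Q′
          sQ′ = sv Q′∈L

          x₀∈Q′ : x₀ ∈ Q′
          x₀∈Q′ = proj₁ (designated-just dQ′)

          Ayz : A y z ≡ false
          Ayz = trans (sym (H≡A uy z)) yz

          z∉Q′ : z ∉ Q′
          z∉Q′ z∈Q′ = true≢false (SVertex-clique symA sQ′ y∈Q′ z∈Q′ (λ y≡z → z≢y (sym y≡z))) Ayz

          Hx₀y : H x₀ y ≡ true
          Hx₀y = trans (symH x₀ y) (trans (H≡A uy x₀) (SVertex-clique symA sQ′ y∈Q′ x₀∈Q′ y≢x₀))

          Ax₀z : A x₀ z ≡ false
          Ax₀z = begin
            A x₀ z  ≡⟨ symA x₀ z ⟩
            A z x₀  ≡⟨ SVertex-module symA sQ′ z z∉Q′ x₀ y x₀∈Q′ y∈Q′ ⟩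
            A z y   ≡⟨ symA z y ⟩
            A y z   ≡⟨ Ayz ⟩
            false   ∎
            where open ≡-Reasoning

          Hx₀z : H x₀ z ≡ true
          Hx₀z = ¬-not λ x₀z →
            true≢false Hx₀y (nonadjacent-trans (shape q) x₀∈ z∈ y∈ x₀z (trans (symH z y) yz))

          z-touched : Touched F z
          z-touched = differs⇒touched {z} {x₀} λ Hz≡Az →
            true≢false (trans (symH z x₀) Hx₀z) (trans Hz≡Az (trans (symA z x₀) Ax₀z))

        second-partner-impossible : ∀ {Qz y″} → Qz ∈ₗ L → designated Qz ≡ just z →
          y″ ∈ Qz → y″ ≢ z → y″ ∈ Hcomp q → Untouched y″ → ⊥
        second-partner-impossible {Qz} {y″} Qz∈L dQz y″∈Qz y″≢z y″∈ uy″ =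
          true≢false Hy″z (nonadjacent-trans (shape q) y″∈ y∈ z∈ Hy″y yz)
          where
          sQz : IsSVertex A Qz
          sQz = sv Qz∈L
          z∈Qz : z ∈ Qz
          z∈Qz = proj₁ (designated-just dQz)
          disjoint : ∀ {w} → w ∈ Qz → w ∉ Q′
          disjoint w∈Qz w∈Q′ = true≢false (subst (λ v → H v y ≡ true) x₀≡z Hx₀y) (trans (symH z y) yz)
            where
            Qz≡Q′ : Qz ≡ Q′
            Qz≡Q′ = QPart-≡-of-shared symA (proj₁ sQz) (proj₁ sQ′) w∈Qz w∈Q′
            x₀≡z : x₀ ≡ z
            x₀≡z = just-injective (trans (sym dQ′) (subst (λ S → designated S ≡ just z) Qz≡Q′ dQz))
          Hy″y : H y″ y ≡ false
          Hy″y = begin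
            H y″ y   ≡⟨ H≡A uy″ y ⟩
            A y″ y   ≡⟨ SVertex-module symA sQ′ y″ (disjoint y″∈Qz) y x₀ y∈Q′ x₀∈Q′ ⟩
            A y″ x₀  ≡⟨ symA y″ x₀ ⟩
            A x₀ y″  ≡⟨ SVertex-module symA sQz x₀ (λ x₀∈Qz → disjoint x₀∈Qz x₀∈Q′) y″ z y″∈Qz z∈Qz ⟩
            A x₀ z   ≡⟨ Ax₀z ⟩
            false    ∎
            where open ≡-Reasoning
          Hy″z : H y″ z ≡ true
          Hy″z = trans (H≡A uy″ z) (SVertex-clique symA sQz y″∈Qz z∈Qz y″≢z)

        non-neighbour-impossible : ⊥
        non-neighbour-impossible =
          let (Qz , Qz∈L , dQz) = designated-part z∈ z-touched
              (y″ , y″∈Qz , y″≢z , y″∈ , uy″) = partner Qz∈L dQz z∈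
          in second-partner-impossible Qz∈L dQz y″∈Qz y″≢z y″∈ uy″

      universal-partner-impossible : ∀ {Q′ x₀ y} → Q′ ∈ₗ L → designated Q′ ≡ just x₀ →
        y ∈ Q′ → y ∈ Hcomp q → Untouched y → Universal y → ⊥
      universal-partner-impossible {Q′} {x₀} Q′∈L dQ′ y∈Q′ y∈ uy univ-y =
        untouched (subst (x₀ ∈_) (sym Q≡Q′) (proj₁ (designated-just dQ′))) (proj₂ (designated-just dQ′))
        where
        Q≡Q′ : Q ≡ Q′
        Q≡Q′ = QPart-≡-of-twins symA (proj₁ sQ) (proj₁ (sv Q′∈L)) q∈Q y∈Q′
                 (untouched-twins (untouched q∈Q) uy (universal⇒twins y∈ univ univ-y))

      -- A touched x₀ ∈ Hcomp q is designated by a part Q′ with a second, untouched, vertex y: if y is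
      -- universal it is a twin of q, and a non-neighbour of y leads to a second such part, which is absurd.
      all-designated-impossible : ⊥
      all-designated-impossible =
        let (x₀ , x₀∈ , touched₀) = component-has-touched q
            (Q′ , Q′∈L , dQ′) = designated-part x₀∈ touched₀
            (y , y∈Q′ , y≢x₀ , y∈ , uy) = partner Q′∈L dQ′ x₀∈
        in [ universal-partner-impossible Q′∈L dQ′ y∈Q′ y∈ uy ,
             (λ (z , z∈ , z≢y , yz) → non-neighbour-impossible Q′∈L dQ′ x₀∈ y∈Q′ y≢x₀ y∈ uy z∈ z≢y yz) ]
           (universal-or-non-neighbour y∈)

    free-vertex : ∀ {Q q} → IsSVertex A Q → (∀ {z} → z ∈ Q → Untouched z) → q ∈ Q →
      ∃ λ x → x ∈ Hcomp q × Touched F x × ¬ DesignatedIn x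
    free-vertex {q = q} sQ untouched q∈Q
      with any? (λ x → x ∈? Hcomp q ×-dec touched? F x ×-dec ¬? (designatedIn? x))
    ... | yes found = found
    ... | no  ∄free = ⊥-elim (all-designated-impossible sQ untouched q∈Q λ {x} x∈ touched →
      decidable-stable (designatedIn? x) λ ¬designated → ∄free (x , x∈ , touched , ¬designated))

    data Charge (Q : Subset n) : Fin n → Set where
      designated-vertex : ∀ {x} → designated Q ≡ just x → Charge Q x
      free-vertex-of    : ∀ {x q} → designated Q ≡ nothing → q ∈ Q → x ∈ Hcomp q → Touched F x →
                          ¬ DesignatedIn x → Charge Q x

    charge : ∀ {Q} → Q ∈ₗ L → ∃ (Charge Q)
    charge {Q} Q∈L with designated Q in dQ
    ... | just x  = x , designated-vertex dQ
    ... | nothing with QPart-nonempty (proj₁ (sv Q∈L))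
    ...   | q , q∈Q with free-vertex (sv Q∈L) (designated-nothing dQ) q∈Q
    ...     | x , x∈ , touched , free = x , free-vertex-of dQ q∈Q x∈ touched free

    charge-∈ : ∀ {Q x} → Charge Q x → x ∈ₗ E
    charge-∈ (designated-vertex dQ)          = touched⇒∈E (proj₂ (designated-just dQ))
    charge-∈ (free-vertex-of _ _ _ touched _) = touched⇒∈E touched

    charge-injective : ∀ {Q₁ Q₂ x} → Q₁ ∈ₗ L → Q₂ ∈ₗ L → Charge Q₁ x → Charge Q₂ x → Q₁ ≡ Q₂
    charge-injective Q₁∈L Q₂∈L (designated-vertex dQ₁) (designated-vertex dQ₂) =
      QPart-≡-of-shared symA (proj₁ (sv Q₁∈L)) (proj₁ (sv Q₂∈L))
        (proj₁ (designated-just dQ₁)) (proj₁ (designated-just dQ₂))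
    charge-injective Q₁∈L _ (designated-vertex dQ₁) (free-vertex-of _ _ _ _ free) =
      ⊥-elim (free (lose Q₁∈L dQ₁))
    charge-injective _ Q₂∈L (free-vertex-of _ _ _ _ free) (designated-vertex dQ₂) =
      ⊥-elim (free (lose Q₂∈L dQ₂))
    charge-injective Q₁∈L Q₂∈L (free-vertex-of dQ₁ q₁∈Q₁ x∈₁ _ _) (free-vertex-of dQ₂ q₂∈Q₂ x∈₂ _ _) =
      QPart-≡-of-twins symA (proj₁ (sv Q₁∈L)) (proj₁ (sv Q₂∈L)) q₁∈Q₁ q₂∈Q₂
        (untouched-twins (designated-nothing dQ₁ q₁∈Q₁) (designated-nothing dQ₂ q₂∈Q₂)
          (universal⇒twins (∈-component-trans symH x∈₁ (∈-component-sym symH x∈₂))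
            (untouched-SVertex-universal (sv Q₁∈L) (designated-nothing dQ₁) q₁∈Q₁)
            (untouched-SVertex-universal (sv Q₂∈L) (designated-nothing dQ₂) q₂∈Q₂)))

    bound : Unique L → length L ≤ length E
    bound unique = length-≤-of-injective-charge Charge unique
      (λ Q∈L → let (x , c) = charge Q∈L in x , charge-∈ c , c) charge-injective

  module _ {Q q} (pQ : IsPVertex A Q) (untouched : ∀ {z} → z ∈ Q → Untouched z) (q∈Q : q ∈ Q) where

    untouched-PVertex-pair : ∃ λ q₂ → q₂ ∈ Q × q₂ ≢ q × q₂ ∈ Hcomp q × H q q₂ ≡ false
    untouched-PVertex-pair with ∃-other (proj₁ (proj₂ pQ)) q∈Q | has-neighbour q
    ... | q₂ , q₂∈Q , q₂≢q | w , qw =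
      q₂ , q₂∈Q , q₂≢q , q₂∈ ,
      trans (H≡A (untouched q∈Q) q₂) (PVertex-independent symA pQ q∈Q q₂∈Q (λ q≡q₂ → q₂≢q (sym q≡q₂)))
      where
      w∉Q : w ∉ Q
      w∉Q w∈Q with w ≟ q
      ... | yes refl = true≢false qw (Graph.irrefl G q)
      ... | no  w≢q  = true≢false qw (PVertex-independent symA pQ q∈Q w∈Q (λ q≡w → w≢q (sym q≡w)))
      w∈ : w ∈ Hcomp q
      w∈ = Hcomp-closed q q w (∈-component q) (trans (H≡A (untouched q∈Q) w) qw)
      q₂∈ : q₂ ∈ Hcomp q
      q₂∈ = Hcomp-closed q w q₂ w∈ (begin
        H w q₂  ≡⟨ H≡Aʳ (untouched q₂∈Q) w ⟩
        A w q₂  ≡⟨ sym (PVertex-module symA pQ w w∉Q q q₂ q∈Q q₂∈Q) ⟩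
        A w q   ≡⟨ symA w q ⟩
        A q w   ≡⟨ qw ⟩
        true    ∎)
        where open ≡-Reasoning

    untouched-PVertex-not-clique : ∀ {x} → q ∈ Hcomp x → ¬ IsCliqueOn H (Hcomp x)
    untouched-PVertex-not-clique q∈ clique with untouched-PVertex-pair
    ... | q₂ , _ , q₂≢q , q₂∈ , qq₂ =
      q₂≢q (sym (clique-nonadjacent⇒≡ clique q∈ (∈-component-trans symH q∈ q₂∈) qq₂))

    untouched-PVertex-neighbour : ∃ λ v → v ∈ Hcomp q × H q v ≡ true
    untouched-PVertex-neighbour with shape q
    ... | inj₁ clique  = ⊥-elim (untouched-PVertex-not-clique (∈-component q) clique)
    ... | inj₂ lclique = lclique-neighbour lclique 2≤ℓ (∈-component q)

    same-colour-as⇒nonadjacent : ∀ {x} → q ∈ Hcomp x → colourIn x q ≡ colourIn x x → H q x ≡ false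
    same-colour-as⇒nonadjacent {x} q∈ = non-clique-same-colour⇒nonadjacent _ (shape x)
      (untouched-PVertex-not-clique q∈) q∈ (∈-component x)

  module PVertexBound (L : List (Subset n)) (pvertices : All (IsPVertex A) L) where

    pv : ∀ {Q} → Q ∈ₗ L → IsPVertex A Q
    pv = All.lookup pvertices

    open Designation L (proj₁ ∘ pv)

    module _ {Q q} (pQ : IsPVertex A Q) (untouched : ∀ {z} → z ∈ Q → Untouched z) (q∈Q : q ∈ Q)
             (all-designated : ∀ {x} → x ∈ Hcomp q → Touched F x → DesignatedIn x × H q x ≡ false) where

      module _ {x₀ w v Q′} (x₀∈ : x₀ ∈ Hcomp q) (x₀w : inF F x₀ w ≡ true)
               (Q′∈L : Q′ ∈ₗ L) (dQ′ : designated Q′ ≡ just x₀) (v∈ : v ∈ Hcomp q) (qv : H q v ≡ true) where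

        private
          pQ′ : IsPVertex A Q′
          pQ′ = pv Q′∈L

          x₀∈Q′ : x₀ ∈ Q′
          x₀∈Q′ = proj₁ (designated-just dQ′)

          touched₀ : Touched F x₀
          touched₀ = w , x₀w

          uv : Untouched v
          uv tv = true≢false qv (proj₂ (all-designated v∈ tv))

          Avx₀ : A v x₀ ≡ true
          Avx₀ = trans (sym (H≡A uv x₀)) (¬-not λ vx₀ → true≢false qv
            (nonadjacent-trans (shape q) (∈-component q) x₀∈ v∈ (proj₂ (all-designated x₀∈ touched₀))
              (trans (symH x₀ v) vx₀)))

          v∉Q′ : v ∉ Q′
          v∉Q′ v∈Q′ = true≢false Avx₀
            (PVertex-independent symA pQ′ v∈Q′ x₀∈Q′ λ v≡x₀ → uv (subst (Touched F) (sym v≡x₀) touched₀))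

          w≢x₀ : w ≢ x₀
          w≢x₀ refl = true≢false x₀w (inF-irrefl F-edition x₀)

        -- v sees x₀, hence all of Q′, so Q′ has an untouched y ∈ Hcomp q non-adjacent to x₀; then the
        -- pair (x₀ , w) of F changes nothing, since A x₀ w = A y w = H y w = H x₀ w.
        partner-edit-impossible : ⊥
        partner-edit-impossible with ∃-other (proj₁ (proj₂ pQ′)) x₀∈Q′
        ... | y , y∈Q′ , y≢x₀ with w ∈? Q′
        ...   | yes w∈Q′ = w≢x₀ (designated-unique Q′∈L dQ′ w∈Q′ (proj₁ (all-designated w∈ w-touched)))
          where
          w∈ : w ∈ Hcomp q
          w∈ = Hcomp-closed q x₀ w x₀∈ (trans (H-edited x₀w)
                 (cong not (PVertex-independent symA pQ′ x₀∈Q′ w∈Q′ (λ x₀≡w → w≢x₀ (sym x₀≡w)))))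
          w-touched : Touched F w
          w-touched = x₀ , trans (inF-sym F w x₀) x₀w
        ...   | no  w∉Q′ = not-¬ refl (begin
            A x₀ w    ≡⟨ symA x₀ w ⟩
            A w x₀    ≡⟨ PVertex-module symA pQ′ w w∉Q′ x₀ y x₀∈Q′ y∈Q′ ⟩
            A w y     ≡⟨ symA w y ⟩
            A y w     ≡⟨ sym (H≡A uy w) ⟩
            H y w     ≡⟨ sym (nonadjacent⇒same-neighbours symH (Hcomp-closed q) (shape q) x₀∈ y∈ Hx₀y w) ⟩
            H x₀ w    ≡⟨ H-edited x₀w ⟩
            not (A x₀ w) ∎)
          where
          open ≡-Reasoning
          y∈ : y ∈ Hcomp q
          y∈ = Hcomp-closed q v y v∈ (trans (H≡A uv y)
                 (trans (sym (PVertex-module symA pQ′ v v∉Q′ x₀ y x₀∈Q′ y∈Q′)) Avx₀))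
          uy : Untouched y
          uy ty = y≢x₀ (designated-unique Q′∈L dQ′ y∈Q′ (proj₁ (all-designated y∈ ty)))
          Hx₀y : H x₀ y ≡ false
          Hx₀y = trans (symH x₀ y) (trans (H≡A uy x₀) (PVertex-independent symA pQ′ y∈Q′ x₀∈Q′ y≢x₀))

      all-designated-impossible : ⊥
      all-designated-impossible with component-has-touched q | untouched-PVertex-neighbour pQ untouched q∈Q
      ... | x₀ , x₀∈ , touched₀@(w , x₀w) | v , v∈ , qv with find (proj₁ (all-designated x₀∈ touched₀))
      ...   | Q′ , Q′∈L , dQ′ = partner-edit-impossible x₀∈ x₀w Q′∈L dQ′ v∈ qv

    free-vertex : ∀ {Q q} → IsPVertex A Q → (∀ {z} → z ∈ Q → Untouched z) → q ∈ Q →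
      ∃ λ x → x ∈ Hcomp q × Touched F x × (DesignatedIn x → H q x ≡ true)
    free-vertex {q = q} pQ untouched q∈Q
      with any? (λ x → x ∈? Hcomp q ×-dec touched? F x ×-dec (designatedIn? x →-dec H q x ≟ᵇ true))
    ... | yes found = found
    ... | no  ∄free = ⊥-elim (all-designated-impossible pQ untouched q∈Q λ {x} x∈ touched →
      let ¬free = λ free → ∄free (x , x∈ , touched , free)
      in decidable-stable (designatedIn? x) (λ ¬designated → ¬free λ d → contradiction d ¬designated) ,
         ¬-not λ adjacent → ¬free λ _ → adjacent)

    data Charge (Q : Subset n) : Fin n × Fin ℓ → Set where
      designated-vertex : ∀ {x i} → designated Q ≡ just x → colourIn x x ≡ i → Charge Q (x , i)
      free-vertex-of    : ∀ {x q i} → designated Q ≡ nothing → q ∈ Q → q ∈ Hcomp x → Touched F x →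
                          (DesignatedIn x → H q x ≡ true) → colourIn x q ≡ i → Charge Q (x , i)

    charge : ∀ {Q} → Q ∈ₗ L → ∃ (Charge Q)
    charge {Q} Q∈L with designated Q in dQ
    ... | just x  = (x , colourIn x x) , designated-vertex dQ refl
    ... | nothing with QPart-nonempty (proj₁ (pv Q∈L))
    ...   | q , q∈Q with free-vertex (pv Q∈L) (designated-nothing dQ) q∈Q
    ...     | x , x∈ , touched , free =
      (x , colourIn x q) , free-vertex-of dQ q∈Q (∈-component-sym symH x∈) touched free refl

    charge-∈ : ∀ {Q t} → Charge Q t → t ∈ₗ cartesianProduct E (allFin ℓ)
    charge-∈ (designated-vertex dQ _) =
      ∈-cartesianProduct⁺ (touched⇒∈E (proj₂ (designated-just dQ))) (∈-allFin _)
    charge-∈ (free-vertex-of _ _ _ touched _ _) = ∈-cartesianProduct⁺ (touched⇒∈E touched) (∈-allFin _)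

    charge-injective : ∀ {Q₁ Q₂ t} → Q₁ ∈ₗ L → Q₂ ∈ₗ L → Charge Q₁ t → Charge Q₂ t → Q₁ ≡ Q₂
    charge-injective Q₁∈L Q₂∈L (designated-vertex dQ₁ _) (designated-vertex dQ₂ _) =
      QPart-≡-of-shared symA (proj₁ (pv Q₁∈L)) (proj₁ (pv Q₂∈L))
        (proj₁ (designated-just dQ₁)) (proj₁ (designated-just dQ₂))
    charge-injective Q₁∈L Q₂∈L (designated-vertex dQ₁ c₁) (free-vertex-of dQ₂ q∈Q₂ q∈ _ free c₂) =
      ⊥-elim (true≢false (free (lose Q₁∈L dQ₁))
        (same-colour-as⇒nonadjacent (pv Q₂∈L) (designated-nothing dQ₂) q∈Q₂ q∈ (trans c₂ (sym c₁))))
    charge-injective Q₁∈L Q₂∈L (free-vertex-of dQ₁ q∈Q₁ q∈ _ free c₁) (designated-vertex dQ₂ c₂) =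
      ⊥-elim (true≢false (free (lose Q₂∈L dQ₂))
        (same-colour-as⇒nonadjacent (pv Q₁∈L) (designated-nothing dQ₁) q∈Q₁ q∈ (trans c₁ (sym c₂))))
    charge-injective Q₁∈L Q₂∈L (free-vertex-of dQ₁ q₁∈Q₁ q₁∈ _ _ c₁) (free-vertex-of dQ₂ q₂∈Q₂ q₂∈ _ _ c₂) =
      same-colour⇒same-part (proj₁ (pv Q₁∈L)) (proj₁ (pv Q₂∈L)) q₁∈Q₁ q₂∈Q₂
        (designated-nothing dQ₁ q₁∈Q₁) (designated-nothing dQ₂ q₂∈Q₂) q₁∈ q₂∈ (trans c₁ (sym c₂))

    bound : Unique L → length L ≤ length E * ℓ
    bound unique = subst (length L ≤_)
      (trans (length-cartesianProduct E (allFin ℓ)) (cong (length E *_) (length-allFin ℓ)))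
      (length-≤-of-injective-charge Charge unique
        (λ Q∈L → let (t , c) = charge Q∈L in t , charge-∈ c , c) charge-injective)

AtMost-≡ : ∀ {n} {B B′ : ℕ} {P : Subset n → Set} → B ≡ B′ → AtMost B P → AtMost B′ P
AtMost-≡ refl atMost = atMost

private
  QPart-arith : ∀ k ℓ → (k + k) + (k + k) * ℓ ≡ (2 * ℓ + 2) * k
  QPart-arith = solve-∀

  PVertex-arith : ∀ k ℓ → (k + k) * ℓ ≡ 2 * ℓ * k
  PVertex-arith = solve-∀

  SVertex-arith : ∀ k → k + k ≡ 2 * k
  SVertex-arith = solve-∀

theorem7 : (ℓ k n : ℕ) → 2 ≤ ℓ → 1 ≤ k → (G : Graph n) →
    (∀ (C : Subset n) → IsComponent (adj G) C →
       ¬ IsCliqueOn (adj G) C × ¬ IsLCliqueOn ℓ (adj G) C) →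
    (F : List (Fin n × Fin n)) → IsEditionSet F → length F ≡ k →
    IsLCluster ℓ (edit (adj G) F) →
    AtMost ((2 * ℓ + 2) * k) (IsQPart (adj G)) ×
    AtMost (2 * ℓ * k) (IsPVertex (adj G)) ×
    AtMost (2 * k) (IsSVertex (adj G))
theorem7 ℓ .(length F) n 2≤ℓ _ G no-cluster-component F F-edition refl cluster =
  AtMost-≡ (trans (cong (λ e → e + e * ℓ) |E|) (QPart-arith (length F) ℓ)) QPartBound.bound ,
  AtMost-≡ (trans (cong (_* ℓ) |E|) (PVertex-arith (length F) ℓ))
    (λ L unique pvertices → PVertexBound.bound L pvertices unique) ,
  AtMost-≡ (trans |E| (SVertex-arith (length F)))
    (λ L unique svertices → SVertexBound.bound L svertices unique)
  where
  open ClusterEditing ℓ 2≤ℓ G no-cluster-component F F-edition cluster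
  |E| : length E ≡ length F + length F
  |E| = length-endpoints F
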